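{- Let $n$ be an odd squarefree integer with $\Omega(n)=3$, all of whose prime divisors are at least $7$, let $p'$ be a prime divisor of $n$ and $A=L(n;p')$. Let $S=(x_1,x_2,x_3)$ be an $A$-extremal sequence for the Davenport constant in $\mathbb{Z}_n$. Then one of the following holds: (i) $S$ is equivalent with respect to $A$ to a sequence $(y_1,y_2,y_3)$ with $y_3\neq 0$, $y_3$ divisible by $n'=n/p'$, and such that the image of $(y_1,y_2)$ under the natural map $\mathbb{Z}_n\to\mathbb{Z}_{n'}$ is an $S(n')$-extremal sequence for the Davenport constant; (ii) $S$ is equivalent with respect to $A$ to a sequence $(y_1,y_2,y_3)$ for which there is a prime divisor $p$ of $n$ such that $y_1$ is the only term not divisible by $p$, and, with $n'=n/p$, $T=(y_2,y_3)$ and $T'$ the image of $T$ under the natural map $\mathbb{Z}_n\to\mathbb{Z}_{n'}$, the sequence $T'$ is an $S(n')$-extremal sequence for the Davenport constant; moreover, if $p\neq p'$, then $T'$ is a $U(n')$-extremal sequence for the Davenport constant.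
   Context: For $m\geq 2$, $\mathbb{Z}_m=\mathbb{Z}/m\mathbb{Z}$, $U(m)$ its unit group; for $d\mid m$ the natural map $\mathbb{Z}_m\to\mathbb{Z}_d$ is reduction mod $d$. For nonempty $A\subseteq\mathbb{Z}_m\setminus\{0\}$, a sequence $(x_1,\ldots,x_l)$ is an $A$-weighted zero-sum sequence if $a_1x_1+\cdots+a_lx_l=0$ for some $a_i\in A$; subsequences are nonempty; $D_A(m)$ is the least $k$ such that every sequence of length $k$ in $\mathbb{Z}_m$ has an $A$-weighted zero-sum subsequence; an $A$-extremal sequence for the Davenport constant is a sequence of length $D_A(m)-1$ with no $A$-weighted zero-sum subsequence. If $A$ is a multiplicative group, sequences $(x_1,\ldots,x_k)$, $(y_1,\ldots,y_k)$ are equivalent with respect to $A$ if there are $a_i\in A$, a unit $c$ and a permutation $\sigma$ with $y_{\sigma(i)}=c\,a_ix_i$ for all $i$. For odd $m=\prod p_i^{r_i}$ and $a\in U(m)$, $\left(\frac{a}{m}\right)=\prod_i\left(\frac{a\bmod p_i}{p_i}\right)^{r_i}$, $\left(\frac{a}{p}\right)$ is the Legendre symbol of $a\bmod p$; $S(m)$ is the kernel of $a\mapsto\left(\frac{a}{m}\right)$ on $U(m)$, and $L(m;p')=\{a\in U(m): \left(\frac{a}{m}\right)=\left(\frac{a}{p'}\right)\}$. $\Omega(n)$ counts prime factors with multiplicity. -}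

module Defs where

open import Data.Nat using (ℕ; zero; suc; _+_; _*_; _≤_)
open import Data.Nat.Divisibility using (_∣_)
open import Data.Nat.Primality using (Prime)
open import Data.Nat.Coprimality using (Coprime)
open import Data.Integer as ℤ using (ℤ; +_)
import Data.Integer.Divisibility as ℤD
open import Data.Fin using (Fin; zero; suc)
open import Data.Fin.Permutation using (Permutation′; _⟨$⟩ʳ_)
open import Data.List using (List; []; _∷_; length)
open import Data.Nat.ListAction using (product)
open import Data.List.Relation.Unary.All using (All)
open import Data.Maybe using (Maybe; just; nothing; Is-just)
open import Data.Sign using (Sign) renaming (_*_ to _*ₛ_)
open import Data.Product using (Σ; ∃; ∃-syntax; _×_)
open import Relation.Nullary using (¬_)
open import Relation.Binary.PropositionalEquality using (_≡_)

-- Elements of ℤ_m are represented by natural-number representatives;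
-- x and y denote the same element of ℤ_m iff m divides x - y (in ℤ).
-- The natural map ℤ_m → ℤ_d (d ∣ m) is then the identity on representatives.
Cong : ℕ → ℕ → ℕ → Set
Cong m x y = (+ m) ℤD.∣ ((+ x) ℤ.- (+ y))

Unit : ℕ → ℕ → Set
Unit m a = Coprime a m

IsQR : ℕ → ℕ → Set
IsQR p a = ∃[ y ] Cong p (y * y) a

data Leg (p a : ℕ) : Sign → Set where
  leg-qr  : IsQR p a → Leg p a Sign.+
  leg-nqr : ¬ IsQR p a → Leg p a Sign.-

data JacList : List ℕ → ℕ → Sign → Set where
  jac-[] : ∀ {a} → JacList [] a Sign.+
  jac-∷  : ∀ {p ps a s t} → Leg p a s → JacList ps a t → JacList (p ∷ ps) a (s *ₛ t)

Jac : ℕ → ℕ → Sign → Set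
Jac m a s = ∃[ ps ] (All Prime ps × product ps ≡ m × JacList ps a s)

SGrp : ℕ → ℕ → Set
SGrp m a = Unit m a × Jac m a Sign.+

LGrp : ℕ → ℕ → ℕ → Set
LGrp m p' a = Unit m a × ∃[ s ] (Jac m a s × Leg p' a s)

BigOmega : ℕ → ℕ → Set
BigOmega n k = ∃[ ps ] (All Prime ps × product ps ≡ n × length ps ≡ k)

SquareFree : ℕ → Set
SquareFree n = ∀ p → Prime p → ¬ ((p * p) ∣ n)

Seq : ℕ → Set
Seq l = Fin l → ℕ

-- weighted sum over a selection: nothing = term not in subsequence,
-- just a = term in subsequence with weight a
wsum : ∀ {l} → (Fin l → Maybe ℕ) → Seq l → ℕ
wsum {zero} w x = 0
wsum {suc l} w x with w zero
... | nothing = wsum (λ i → w (suc i)) (λ i → x (suc i))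
... | just a  = a * x zero + wsum (λ i → w (suc i)) (λ i → x (suc i))

HasWZS : ℕ → (ℕ → Set) → ∀ {l} → Seq l → Set
HasWZS m A {l} x =
  ∃[ w ] ((∃[ i ] Is-just (w i))
         × (∀ i a → w i ≡ just a → A a)
         × m ∣ wsum {l} w x)

AllHaveWZS : ℕ → (ℕ → Set) → ℕ → Set
AllHaveWZS m A k = (x : Seq k) → HasWZS m A x

IsDavenport : ℕ → (ℕ → Set) → ℕ → Set
IsDavenport m A k = AllHaveWZS m A k × (∀ j → AllHaveWZS m A j → k ≤ j)

Extremal : ℕ → (ℕ → Set) → ∀ {l} → Seq l → Set
Extremal m A {l} x = IsDavenport m A (suc l) × ¬ HasWZS m A x

Equiv : ℕ → (ℕ → Set) → ∀ {l} → Seq l → Seq l → Set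
Equiv m A {l} x y =
  Σ (Fin l → ℕ) λ a → Σ ℕ λ c → Σ (Permutation′ l) λ σ →
    ((∀ i → A (a i)) × Unit m c
     × (∀ i → Cong m (y (σ ⟨$⟩ʳ i)) (c * a i * x i)))

-- Write n = pqr with p = p′.  By the Chinese remainder theorem a weight in
-- L(n; p) amounts to nonzero weights modulo p, q and r whose Legendre symbols at
-- q and r agree, and similarly for S(qr).  Modulo a prime ≥ 7 non-residues exist
-- and every diagonal conic αX² + βY² + γZ² ≡ 0 has a solution with XYZ ≢ 0; this
-- yields an S(qr)-weighted zero-sum in every triple, so D_{S(qr)}(qr) = 3.  Such a
-- zero-sum lifts to an L-weighted zero-sum unless exactly one of its terms is
-- nonzero modulo p.  Running through the possible divisibilities of the terms by
-- p, q and r, this obstruction leaves only the configurations (i) and (ii), and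
-- the pairs occurring there are zero-sum free, hence extremal.

module Submission where

open import Defs
open import Data.Nat as ℕ using (ℕ; zero; suc; NonZero; _≤_; _<_; z≤n; s≤s; _≤?_)
import Data.Nat.Properties as ℕP
open import Data.Nat.Divisibility as ℕD using (divides; _∣?_; _∣_)
import Data.Nat.DivMod as ℕM
open import Data.Nat.Primality
open import Data.Nat.Coprimality as Cop using (Coprime; coprime-divisor; coprime-Bézout)
open import Data.Nat.GCD using (module Bézout)
open import Data.Nat.ListAction using (product)
import Data.Nat.Tactic.RingSolver as NS
open import Data.Integer as ℤ using (ℤ; +_; -_; _+_; _*_; _-_)
import Data.Integer.Properties as ℤP
import Data.Integer.Divisibility as ℤD
import Data.Integer.Divisibility.Signed as ℤS
import Data.Integer.DivMod as ℤM
open import Data.Integer.Tactic.RingSolver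
open import Data.Fin as F using (Fin; zero; suc; toℕ; fromℕ<; inject₁)
open import Data.Fin.Patterns using (0F; 1F; 2F)
import Data.Fin.Properties as FP
open import Data.Fin.Permutation as Perm using (Permutation′; _⟨$⟩ˡ_; inverseˡ)
open import Data.Product
open import Data.Sum
open import Data.Sign as Sg using (Sign)
open import Data.Empty
open import Data.Unit using (tt)
open import Data.Bool using (Bool; true; false; T; _∨_)
open import Data.List using ([]; _∷_)
open import Data.List.Relation.Unary.All using (All; []; _∷_)
open import Data.Maybe using (Maybe; just; nothing; Is-just)
open import Data.Maybe.Relation.Unary.Any using (just)
open import Relation.Nullary
open import Relation.Nullary.Decidable using (decidable-stable; map′)
open import Relation.Binary.PropositionalEquality
open import Function using (_∘_)

-- A record rather than (+ p) ℤD.∣ a, which unfolds to ∣ + p ∣ ∣ ∣ a ∣ and so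
-- leaves p uninferable from the type.
record ZeroMod (p : ℕ) (a : ℤ) : Set where
  constructor zeroMod
  field ∣-of-zeroMod : (+ p) ℤD.∣ a
open ZeroMod public

record EqMod (p : ℕ) (a b : ℤ) : Set where
  constructor eqMod
  field zeroMod-of-eqMod : ZeroMod p (a - b)
open EqMod public

NonZeroMod : ℕ → ℤ → Set
NonZeroMod p a = ¬ ZeroMod p a

module _ {p : ℕ} where
  zeroMod-resp-≡ : ∀ {a b} → a ≡ b → ZeroMod p a → ZeroMod p b
  zeroMod-resp-≡ refl d = d

  zeroMod-0 : ZeroMod p (+ 0)
  zeroMod-0 = zeroMod (ℕD._∣0 p)

  zeroMod-p : ZeroMod p (+ p)
  zeroMod-p = zeroMod ℕD.∣-refl

  zeroMod-+ : ∀ {a b} → ZeroMod p a → ZeroMod p b → ZeroMod p (a + b)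
  zeroMod-+ {a} {b} (zeroMod x) (zeroMod y) =
    zeroMod (ℤS.∣⇒∣ᵤ {+ p} {a + b} (ℤS.∣m∣n⇒∣m+n (ℤS.∣ᵤ⇒∣ {+ p} {a} x) (ℤS.∣ᵤ⇒∣ {+ p} {b} y)))

  zeroMod-neg : ∀ {a} → ZeroMod p a → ZeroMod p (- a)
  zeroMod-neg {a} (zeroMod x) = zeroMod (ℤS.∣⇒∣ᵤ {+ p} { - a} (ℤS.∣m⇒∣-m (ℤS.∣ᵤ⇒∣ {+ p} {a} x)))

  zeroMod-*ˡ : ∀ m {b} → ZeroMod p b → ZeroMod p (m * b)
  zeroMod-*ˡ m {b} (zeroMod x) = zeroMod (ℤS.∣⇒∣ᵤ {+ p} {m * b} (ℤS.∣n⇒∣m*n m (ℤS.∣ᵤ⇒∣ {+ p} {b} x)))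

  zeroMod-*ʳ : ∀ {a} m → ZeroMod p a → ZeroMod p (a * m)
  zeroMod-*ʳ {a} m (zeroMod x) = zeroMod (ℤS.∣⇒∣ᵤ {+ p} {a * m} (ℤS.∣m⇒∣m*n m (ℤS.∣ᵤ⇒∣ {+ p} {a} x)))

  eqMod-refl : ∀ {a} → EqMod p a a
  eqMod-refl {a} = eqMod (zeroMod-resp-≡ (sym (ℤP.+-inverseʳ a)) zeroMod-0)

  eqMod-sym : ∀ {a b} → EqMod p a b → EqMod p b a
  eqMod-sym {a} {b} (eqMod d) = eqMod (zeroMod-resp-≡ (identity a b) (zeroMod-neg d))
    where
    identity : ∀ a b → - (a - b) ≡ b - a
    identity = solve-∀

  eqMod-trans : ∀ {a b c} → EqMod p a b → EqMod p b c → EqMod p a c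
  eqMod-trans {a} {b} {c} (eqMod d) (eqMod e) = eqMod (zeroMod-resp-≡ (identity a b c) (zeroMod-+ d e))
    where
    identity : ∀ a b c → (a - b) + (b - c) ≡ a - c
    identity = solve-∀

  eqMod-+ : ∀ {a a′ b b′} → EqMod p a a′ → EqMod p b b′ → EqMod p (a + b) (a′ + b′)
  eqMod-+ {a} {a′} {b} {b′} (eqMod d) (eqMod e) =
    eqMod (zeroMod-resp-≡ (identity a a′ b b′) (zeroMod-+ d e))
    where
    identity : ∀ a a′ b b′ → (a - a′) + (b - b′) ≡ (a + b) - (a′ + b′)
    identity = solve-∀

  eqMod-* : ∀ {a a′ b b′} → EqMod p a a′ → EqMod p b b′ → EqMod p (a * b) (a′ * b′)
  eqMod-* {a} {a′} {b} {b′} (eqMod d) (eqMod e) =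
    eqMod (zeroMod-resp-≡ (identity a a′ b b′) (zeroMod-+ (zeroMod-*ʳ b d) (zeroMod-*ˡ a′ e)))
    where
    identity : ∀ a a′ b b′ → (a - a′) * b + a′ * (b - b′) ≡ a * b - a′ * b′
    identity = solve-∀

  eqMod-neg : ∀ {a a′} → EqMod p a a′ → EqMod p (- a) (- a′)
  eqMod-neg {a} {a′} (eqMod d) = eqMod (zeroMod-resp-≡ (identity a a′) (zeroMod-neg d))
    where
    identity : ∀ a a′ → - (a - a′) ≡ (- a) - (- a′)
    identity = solve-∀

  ≡⇒eqMod : ∀ {a b} → a ≡ b → EqMod p a b
  ≡⇒eqMod refl = eqMod-refl

  zeroMod⇒eqMod0 : ∀ {a} → ZeroMod p a → EqMod p a (+ 0)
  zeroMod⇒eqMod0 {a} d = eqMod (zeroMod-resp-≡ (sym (ℤP.+-identityʳ a)) d)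

  eqMod0⇒zeroMod : ∀ {a} → EqMod p a (+ 0) → ZeroMod p a
  eqMod0⇒zeroMod {a} (eqMod d) = zeroMod-resp-≡ (ℤP.+-identityʳ a) d

  zeroMod-respˡ : ∀ {a b} → EqMod p a b → ZeroMod p b → ZeroMod p a
  zeroMod-respˡ {a} {b} (eqMod e) d = zeroMod-resp-≡ (identity a b) (zeroMod-+ e d)
    where
    identity : ∀ a b → (a - b) + b ≡ a
    identity = solve-∀

  nonZeroMod-resp : ∀ {a b} → EqMod p a b → NonZeroMod p a → NonZeroMod p b
  nonZeroMod-resp e n d = n (zeroMod-respˡ e d)

  eqMod-+*p : ∀ k a → EqMod p (a + k * + p) a
  eqMod-+*p k a = eqMod (zeroMod-resp-≡ (identity a k (+ p)) (zeroMod-*ˡ k zeroMod-p))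
    where
    identity : ∀ a k p → k * p ≡ (a + k * p) - a
    identity = solve-∀

  eqMod-cancelˡ-+ : ∀ {c a b} → EqMod p (c + a) (c + b) → EqMod p a b
  eqMod-cancelˡ-+ {c} {a} {b} (eqMod d) = eqMod (zeroMod-resp-≡ (identity c a b) d)
    where
    identity : ∀ c a b → (c + a) - (c + b) ≡ a - b
    identity = solve-∀

  drop-zero-term : ∀ a b → ZeroMod p a → EqMod p (a + b) (+ 0) → EqMod p b (+ 0)
  drop-zero-term a b a≡0 e =
    eqMod-trans (≡⇒eqMod (identity a b)) (eqMod-+ (eqMod-neg (zeroMod⇒eqMod0 a≡0)) e)
    where
    identity : ∀ a b → b ≡ - a + (a + b)
    identity = solve-∀

  eqMod⇒∣ : ∀ {a b} → EqMod p a b → (+ p) ℤD.∣ (a - b)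
  eqMod⇒∣ e = ∣-of-zeroMod (zeroMod-of-eqMod e)

  ∣⇒eqMod : ∀ {a b} → (+ p) ℤD.∣ (a - b) → EqMod p a b
  ∣⇒eqMod c = eqMod (zeroMod c)

zeroMod? : ∀ p a → Dec (ZeroMod p a)
zeroMod? p a = map′ zeroMod ∣-of-zeroMod (p ∣? ℤ.∣ a ∣)

eqMod? : ∀ p a b → Dec (EqMod p a b)
eqMod? p a b = map′ eqMod zeroMod-of-eqMod (zeroMod? p (a - b))

nonZeroMod-< : ∀ {p k} → 0 < k → k < p → NonZeroMod p (+ k)
nonZeroMod-< {p} {k} 0<k k<p (zeroMod d) = ℕP.<⇒≱ k<p (ℕD.∣⇒≤ {{ℕ.>-nonZero 0<k}} d)

%-eqMod : ∀ p .{{_ : NonZero p}} m → EqMod p (+ (m ℕ.% p)) (+ m)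
%-eqMod p m = eqMod-sym (subst (λ t → EqMod p t (+ (m ℕ.% p))) (sym m≡) (eqMod-+*p (+ (m ℕ./ p)) (+ (m ℕ.% p))))
  where
  m≡ : + m ≡ + (m ℕ.% p) + + (m ℕ./ p) * + p
  m≡ = trans (cong +_ (ℕM.m≡m%n+[m/n]*n m p))
             (trans (ℤP.pos-+ (m ℕ.% p) _) (cong (_+_ (+ (m ℕ.% p))) (ℤP.pos-* (m ℕ./ p) p)))

%≡⇒eqMod : ∀ p .{{_ : NonZero p}} m n → m ℕ.% p ≡ n ℕ.% p → EqMod p (+ m) (+ n)
%≡⇒eqMod p m n e = eqMod-trans (eqMod-sym (%-eqMod p m)) (eqMod-trans (≡⇒eqMod (cong +_ e)) (%-eqMod p n))

square-eqMod : ∀ {p a b} → EqMod p (+ a) (+ b) → EqMod p (+ (a ℕ.* a)) (+ (b ℕ.* b))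
square-eqMod {a = a} {b} e =
  eqMod-trans (≡⇒eqMod (ℤP.pos-* a a)) (eqMod-trans (eqMod-* e e) (≡⇒eqMod (sym (ℤP.pos-* b b))))

representative : (p : ℕ) .{{_ : NonZero p}} → (z : ℤ) → Σ ℕ λ w → EqMod p (+ w) z
representative p z =
  z ℤ.%ℕ p ,
  eqMod-sym (subst (λ t → EqMod p t (+ (z ℤ.%ℕ p))) (sym (ℤM.a≡a%ℕn+[a/ℕn]*n z p)) (eqMod-+*p (z ℤ./ℕ p) (+ (z ℤ.%ℕ p))))

prime≢1 : ∀ {p} → Prime p → p ≢ 1
prime≢1 pr = ℕ.nonTrivial⇒≢1 {{prime⇒nonTrivial pr}}

euclid-zeroMod : ∀ {p} → Prime p → ∀ a b → ZeroMod p (a * b) → ZeroMod p a ⊎ ZeroMod p b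
euclid-zeroMod {p} pr a b (zeroMod d) =
  Data.Sum.map zeroMod zeroMod (euclidsLemma ℤ.∣ a ∣ ℤ.∣ b ∣ pr (subst (p ℕD.∣_) (ℤP.abs-* a b) d))

nonZeroMod-* : ∀ {p} → Prime p → ∀ {a b} → NonZeroMod p a → NonZeroMod p b → NonZeroMod p (a * b)
nonZeroMod-* pr {a} {b} na nb d = [ na , nb ]′ (euclid-zeroMod pr a b d)

nonZeroMod-*ℕ : ∀ {p} → Prime p → ∀ {c v} → NonZeroMod p (+ c) → NonZeroMod p (+ v) → NonZeroMod p (+ (c ℕ.* v))
nonZeroMod-*ℕ pr {c} {v} nc nv d = nonZeroMod-* pr nc nv (zeroMod-resp-≡ (ℤP.pos-* c v) d)

¬∣⇒coprime : ∀ {q a} → Prime q → ¬ (q ∣ a) → Coprime a q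
¬∣⇒coprime pq nd {d} (d∣a , d∣q) with prime⇒irreducible pq d∣q
... | inj₁ d≡1 = d≡1
... | inj₂ refl = ⊥-elim (nd d∣a)

inverseℕ : ∀ {p} → Prime p → (w : ℕ) → ¬ (p ∣ w) → Σ ℤ λ b → EqMod p (+ w * b) (+ 1)
inverseℕ {p} pr w p∤w with coprime-Bézout (¬∣⇒coprime pr p∤w)
... | Bézout.+- x y eq = + x , eqMod (zeroMod-resp-≡ yp≡ (zeroMod-*ˡ (+ y) zeroMod-p))
  where
  open ≡-Reasoning
  identity : ∀ t → t ≡ (+ 1 + t) - + 1
  identity = solve-∀
  yp≡ : + y * + p ≡ + w * + x - + 1
  yp≡ = begin
    + y * + p                 ≡⟨ identity (+ y * + p) ⟩
    (+ 1 + + y * + p) - + 1   ≡⟨ cong (λ t → + 1 + t - + 1) (sym (ℤP.pos-* y p)) ⟩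
    + (1 ℕ.+ y ℕ.* p) - + 1   ≡⟨ cong (λ t → + t - + 1) eq ⟩
    + (x ℕ.* w) - + 1         ≡⟨ cong (_- + 1) (trans (ℤP.pos-* x w) (ℤP.*-comm (+ x) (+ w))) ⟩
    + w * + x - + 1           ∎
... | Bézout.-+ x y eq = - + x , eqMod (zeroMod-resp-≡ -yp≡ (zeroMod-neg (zeroMod-*ˡ (+ y) zeroMod-p)))
  where
  open ≡-Reasoning
  identity : ∀ x w → - (+ 1 + x * w) ≡ w * (- x) - + 1
  identity = solve-∀
  -yp≡ : - (+ y * + p) ≡ + w * (- + x) - + 1
  -yp≡ = begin
    - (+ y * + p)            ≡⟨ cong -_ (sym (ℤP.pos-* y p)) ⟩
    - (+ (y ℕ.* p))          ≡⟨ cong (λ t → - (+ t)) (sym eq) ⟩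
    - (+ (1 ℕ.+ x ℕ.* w))    ≡⟨ cong (λ t → - (+ 1 + t)) (ℤP.pos-* x w) ⟩
    - (+ 1 + + x * + w)      ≡⟨ identity (+ x) (+ w) ⟩
    + w * (- + x) - + 1      ∎

inverse : ∀ {p} → Prime p → (a : ℤ) → NonZeroMod p a → Σ ℤ λ b → EqMod p (a * b) (+ 1)
inverse {p} pr a na =
  let instance _ = prime⇒nonZero pr
      w , w≡a = representative p a
      b , wb≡1 = inverseℕ pr w (λ p∣w → na (zeroMod-respˡ (eqMod-sym w≡a) (zeroMod p∣w)))
  in b , eqMod-trans (eqMod-* (eqMod-sym w≡a) (eqMod-refl {a = b})) wb≡1

eqMod-cancelˡ-* : ∀ {p} → Prime p → ∀ {u a b} → NonZeroMod p u → EqMod p (u * a) (u * b) → EqMod p a b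
eqMod-cancelˡ-* {p} pr {u} {a} {b} nu e =
  let v , uv≡1 = inverse pr u nu
      undo : ∀ c → EqMod p (v * (u * c)) c
      undo c = eqMod-trans (≡⇒eqMod (identity u v c)) (eqMod-trans (eqMod-* uv≡1 (eqMod-refl {a = c})) (≡⇒eqMod (ℤP.*-identityˡ c)))
  in eqMod-trans (eqMod-sym (undo a)) (eqMod-trans (eqMod-* (eqMod-refl {a = v}) e) (undo b))
  where
  identity : ∀ u v c → v * (u * c) ≡ u * v * c
  identity = solve-∀

-- Quadratic residues

isQR? : ∀ p → .{{NonZero p}} → ∀ a → Dec (IsQR p a)
isQR? p a with FP.any? (λ (i : Fin p) → eqMod? p (+ (toℕ i ℕ.* toℕ i)) (+ a))
... | yes (i , e) = yes (toℕ i , eqMod⇒∣ e)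
... | no ¬root = no λ (y , e) → ¬root (fromℕ< (ℕM.m%n<n y p) , reduced-root y (∣⇒eqMod e))
  where
  reduced-root : ∀ y → EqMod p (+ (y ℕ.* y)) (+ a) → EqMod p (+ (toℕ (fromℕ< (ℕM.m%n<n y p)) ℕ.* toℕ (fromℕ< (ℕM.m%n<n y p)))) (+ a)
  reduced-root y e rewrite FP.toℕ-fromℕ< (ℕM.m%n<n y p) = eqMod-trans (square-eqMod (%-eqMod p y)) e

legendre : ∀ p → .{{NonZero p}} → ∀ a → Σ Sign (Leg p a)
legendre p a with isQR? p a
... | yes q = Sg.+ , leg-qr q
... | no q = Sg.- , leg-nqr q

isQR-resp : ∀ {p a b} → EqMod p (+ a) (+ b) → IsQR p a → IsQR p b
isQR-resp {p} {a} {b} e (y , d) = y , eqMod⇒∣ (eqMod-trans (∣⇒eqMod {p} {+ (y ℕ.* y)} {+ a} d) e)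

leg-resp : ∀ {p a b s} → EqMod p (+ a) (+ b) → Leg p a s → Leg p b s
leg-resp e (leg-qr x) = leg-qr (isQR-resp e x)
leg-resp e (leg-nqr x) = leg-nqr λ q → x (isQR-resp (eqMod-sym e) q)

leg-square : ∀ {p} X → Leg p (X ℕ.* X) Sg.+
leg-square X = leg-qr (X , eqMod⇒∣ (eqMod-refl {a = + (X ℕ.* X)}))

squares-distinct : ∀ {p h} → Prime p → p ≡ suc (h ℕ.+ h) → ∀ {a b} → a < b → b ≤ h →
                   ¬ EqMod p (+ (a ℕ.* a)) (+ (b ℕ.* b))
squares-distinct {p} {h} pr p≡ {a} {b} a<b b≤h e =
  [ nonZeroMod-< 0<d d<p , nonZeroMod-< 0<b+a b+a<p ]′
    (euclid-zeroMod pr (+ d) (+ (b ℕ.+ a)) (zeroMod-resp-≡ difference (zeroMod-of-eqMod (eqMod-sym e))))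
  where
  d : ℕ
  d = b ℕ.∸ a
  0<d : 0 < d
  0<d = ℕP.m<n⇒0<n∸m a<b
  b+a<p : b ℕ.+ a < p
  b+a<p = subst (b ℕ.+ a <_) (sym p≡) (s≤s (ℕP.+-mono-≤ b≤h (ℕP.≤-trans (ℕP.<⇒≤ a<b) b≤h)))
  d<p : d < p
  d<p = ℕP.≤-<-trans (ℕP.≤-trans (ℕP.m∸n≤m b a) (ℕP.m≤m+n b a)) b+a<p
  0<b+a : 0 < b ℕ.+ a
  0<b+a = ℕP.<-≤-trans 0<d (ℕP.≤-trans (ℕP.m∸n≤m b a) (ℕP.m≤m+n b a))
  difference : + (b ℕ.* b) - + (a ℕ.* a) ≡ + d * + (b ℕ.+ a)
  difference = begin
    + (b ℕ.* b) - + (a ℕ.* a)            ≡⟨ cong₂ _-_ (ℤP.pos-* b b) (ℤP.pos-* a a) ⟩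
    + b * + b - + a * + a                ≡⟨ cong (λ t → t * t - + a * + a) b≡ ⟩
    (+ d + + a) * (+ d + + a) - + a * + a ≡⟨ identity (+ d) (+ a) ⟩
    + d * (+ d + + a + + a)              ≡⟨ cong (λ t → + d * (t + + a)) (sym b≡) ⟩
    + d * (+ b + + a)                    ≡⟨ cong (+ d *_) (sym (ℤP.pos-+ b a)) ⟩
    + d * + (b ℕ.+ a)                    ∎
    where
    open ≡-Reasoning
    identity : ∀ d a → (d + a) * (d + a) - a * a ≡ d * (d + a + a)
    identity = solve-∀
    b≡ : + b ≡ + d + + a
    b≡ = trans (cong +_ (sym (ℕP.m∸n+n≡m (ℕP.<⇒≤ a<b)))) (ℤP.pos-+ d a)

small-sqrt : ∀ {p h} → Prime p → p ≡ suc (h ℕ.+ h) → ∀ c → NonZeroMod p (+ c) → IsQR p c →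
             Σ ℕ λ r → 0 < r × r ≤ h × EqMod p (+ (r ℕ.* r)) (+ c)
small-sqrt {p} {h} pr p≡ c nc (y , y²≡c) =
  fold (y ℕ.% p) (ℕM.m%n<n y p) (eqMod-trans (square-eqMod (%-eqMod p y)) (∣⇒eqMod y²≡c))
  where
  instance _ = prime⇒nonZero pr
  fold : ∀ y → y < p → EqMod p (+ (y ℕ.* y)) (+ c) → Σ ℕ λ r → 0 < r × r ≤ h × EqMod p (+ (r ℕ.* r)) (+ c)
  fold zero _ e = ⊥-elim (nc (zeroMod-respˡ (eqMod-sym e) zeroMod-0))
  fold (suc y) y<p e with suc y ≤? h
  ... | yes y≤h = suc y , s≤s z≤n , y≤h , e
  ... | no y≰h = p ℕ.∸ suc y , ℕP.m<n⇒0<n∸m y<p , p-y≤h , eqMod-trans (≡⇒eqMod (ℤP.pos-* (p ℕ.∸ suc y) (p ℕ.∸ suc y)))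
                    (eqMod-trans (eqMod-* p-y≡-y p-y≡-y) (eqMod-trans (≡⇒eqMod (trans (neg-square (+ suc y)) (sym (ℤP.pos-* (suc y) (suc y))))) e))
    where
    neg-square : ∀ a → (- a) * (- a) ≡ a * a
    neg-square = solve-∀
    p-y≤h : p ℕ.∸ suc y ≤ h
    p-y≤h = ℕP.≤-trans (ℕP.∸-monoʳ-≤ p (ℕP.≰⇒> y≰h)) (ℕP.≤-reflexive (trans (cong (ℕ._∸ suc h) p≡) (ℕP.m+n∸m≡n h h)))
    p-y≡-y : EqMod p (+ (p ℕ.∸ suc y)) (- + suc y)
    p-y≡-y = eqMod (zeroMod-resp-≡ p-as-sum zeroMod-p)
      where
      p-as-sum : + p ≡ + (p ℕ.∸ suc y) - - + suc y
      p-as-sum = trans (sym (cong +_ (ℕP.m∸n+n≡m (ℕP.<⇒≤ y<p))))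
                 (trans (ℤP.pos-+ (p ℕ.∸ suc y) (suc y)) (cong (_+_ (+ (p ℕ.∸ suc y))) (sym (ℤP.neg-involutive (+ suc y)))))

1+k<p : ∀ {p h} → p ≡ suc (h ℕ.+ h) → (k : Fin (h ℕ.+ h)) → suc (toℕ k) < p
1+k<p p≡ k = subst (suc (toℕ k) <_) (sym p≡) (s≤s (FP.toℕ<n k))

-- If 1, …, 2h were all squares, their square roots in [1, h] would be pairwise
-- distinct residues, which the pigeonhole principle forbids.
nonResidue : ∀ {p h} → Prime p → p ≡ suc (h ℕ.+ h) → 0 < h → Σ ℕ λ c → NonZeroMod p (+ c) × ¬ IsQR p c
nonResidue {p} {h} pr p≡ 0<h with FP.any? (λ (k : Fin (h ℕ.+ h)) → ¬? (isQR? p {{prime⇒nonZero pr}} (suc (toℕ k))))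
... | yes (k , ¬qr) = suc (toℕ k) , nonZeroMod-< (s≤s z≤n) (1+k<p {h = h} p≡ k) , ¬qr
... | no ¬nonResidue = ⊥-elim (roots-injective (FP.pigeonhole (ℕP.m<m+n h 0<h) root-1))
  where
  root : ∀ (k : Fin (h ℕ.+ h)) → Σ ℕ λ r → 0 < r × r ≤ h × EqMod p (+ (r ℕ.* r)) (+ suc (toℕ k))
  root k = small-sqrt pr p≡ (suc (toℕ k)) (nonZeroMod-< (s≤s z≤n) (1+k<p {h = h} p≡ k))
             (decidable-stable (isQR? p {{prime⇒nonZero pr}} (suc (toℕ k))) (λ ¬qr → ¬nonResidue (k , ¬qr)))
  pred< : ∀ {r} → 0 < r → r ≤ h → r ℕ.∸ 1 < h
  pred< {suc r} _ r≤h = r≤h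
  root-1 : Fin (h ℕ.+ h) → Fin h
  root-1 k = let _ , 0<r , r≤h , _ = root k in fromℕ< (pred< 0<r r≤h)
  roots-injective : ¬ (∃₂ λ i j → i F.< j × root-1 i ≡ root-1 j)
  roots-injective (i , j , i<j , same) =
    nonZeroMod-< (ℕP.m<n⇒0<n∸m i<j) d<p (zeroMod-resp-≡ difference (zeroMod-of-eqMod j≡i))
    where
    ri : Σ ℕ λ r → 0 < r × r ≤ h × EqMod p (+ (r ℕ.* r)) (+ suc (toℕ i))
    ri = root i
    rj : Σ ℕ λ r → 0 < r × r ≤ h × EqMod p (+ (r ℕ.* r)) (+ suc (toℕ j))
    rj = root j
    ri≡rj : proj₁ ri ≡ proj₁ rj
    ri≡rj = trans (sym (ℕP.m∸n+n≡m (proj₁ (proj₂ ri))))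
                  (trans (cong (ℕ._+ 1) (trans (sym (FP.toℕ-fromℕ< _)) (trans (cong toℕ same) (FP.toℕ-fromℕ< _))))
                         (ℕP.m∸n+n≡m (proj₁ (proj₂ rj))))
    j≡i : EqMod p (+ suc (toℕ j)) (+ suc (toℕ i))
    j≡i = eqMod-trans (eqMod-sym (proj₂ (proj₂ (proj₂ rj))))
            (eqMod-trans (≡⇒eqMod (cong (λ t → + (t ℕ.* t)) (sym ri≡rj))) (proj₂ (proj₂ (proj₂ ri))))
    d : ℕ
    d = toℕ j ℕ.∸ toℕ i
    d<p : d < p
    d<p = ℕP.≤-<-trans (ℕP.m∸n≤m (toℕ j) (toℕ i)) (ℕP.<-trans (ℕP.n<1+n _) (1+k<p {h = h} p≡ j))
    identity : ∀ a b → (+ 1 + (a + b)) - (+ 1 + b) ≡ a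
    identity = solve-∀
    difference : + suc (toℕ j) - + suc (toℕ i) ≡ + d
    difference = trans (cong (λ t → + suc t - + suc (toℕ i)) (sym (ℕP.m∸n+n≡m (ℕP.<⇒≤ i<j)))) (identity (+ d) (+ toℕ i))

-- The h + 1 values α a² (a ≤ h) are pairwise distinct, and so are the h + 1
-- values c - β b² (b ≤ h); among these p + 1 residues two coincide, necessarily
-- one of each kind.  The index n ≤ p encodes a = n for n ≤ h and b = n - (h + 1)
-- otherwise, and -β is replaced by a natural representative β′.
diagonal-form-represents : ∀ {p h} → Prime p → p ≡ suc (h ℕ.+ h) → (α β c : ℕ) → NonZeroMod p (+ α) → NonZeroMod p (+ β) →
                           Σ ℕ λ x → Σ ℕ λ y → EqMod p (+ (α ℕ.* (x ℕ.* x)) + + (β ℕ.* (y ℕ.* y))) (+ c)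
diagonal-form-represents {p} {h} pr p≡ α β c nα nβ =
  let i , j , i<j , same = FP.pigeonhole (ℕP.n<1+n p) reduced
  in collision (toℕ i) (toℕ j) i<j (ℕP.≤-pred (FP.toℕ<n j)) (toℕ i ℕ.≤? h) (toℕ j ℕ.≤? h)
       (%≡⇒eqMod p _ _ (trans (sym (FP.toℕ-fromℕ< _)) (trans (cong toℕ same) (FP.toℕ-fromℕ< _))))
  where
  instance _ = prime⇒nonZero pr
  β′ : ℕ
  β′ = proj₁ (representative p (- + β))
  β′≡-β : EqMod p (+ β′) (- + β)
  β′≡-β = proj₂ (representative p (- + β))
  nβ′ : NonZeroMod p (+ β′)
  nβ′ d = nβ (zeroMod-resp-≡ (ℤP.neg-involutive (+ β)) (zeroMod-neg (zeroMod-respˡ (eqMod-sym β′≡-β) d)))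
  value : (n : ℕ) → Dec (n ≤ h) → ℕ
  value n (yes _) = α ℕ.* (n ℕ.* n)
  value n (no _) = c ℕ.+ β′ ℕ.* ((n ℕ.∸ suc h) ℕ.* (n ℕ.∸ suc h))
  reduced : Fin (suc p) → Fin p
  reduced k = fromℕ< (ℕM.m%n<n (value (toℕ k) (toℕ k ℕ.≤? h)) p)
  scaled-cancel : ∀ {u a b} → NonZeroMod p (+ u) → EqMod p (+ (u ℕ.* (a ℕ.* a))) (+ (u ℕ.* (b ℕ.* b))) →
                  EqMod p (+ (a ℕ.* a)) (+ (b ℕ.* b))
  scaled-cancel {u} {a} {b} nu e = eqMod-cancelˡ-* pr nu
    (eqMod-trans (≡⇒eqMod (sym (ℤP.pos-* u (a ℕ.* a)))) (eqMod-trans e (≡⇒eqMod (ℤP.pos-* u (b ℕ.* b)))))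
  cancel-β : ∀ y → EqMod p (+ (c ℕ.+ β′ ℕ.* (y ℕ.* y)) + + (β ℕ.* (y ℕ.* y))) (+ c)
  cancel-β y =
    eqMod-trans (≡⇒eqMod (trans (cong₂ _+_ (trans (ℤP.pos-+ c _) (cong (_+_ (+ c)) (ℤP.pos-* β′ _))) (ℤP.pos-* β _))
                               (regroup (+ c) (+ β′) (+ β) (+ (y ℕ.* y)))))
      (eqMod-trans (eqMod-+ (eqMod-refl {a = + c}) (eqMod-* (eqMod-+ β′≡-β (eqMod-refl {a = + β})) (eqMod-refl {a = + (y ℕ.* y)})))
        (≡⇒eqMod (vanish (+ c) (+ β) (+ (y ℕ.* y)))))
    where
    regroup : ∀ c b′ b y² → c + b′ * y² + b * y² ≡ c + (b′ + b) * y²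
    regroup = solve-∀
    vanish : ∀ c b y² → c + (- b + b) * y² ≡ c
    vanish = solve-∀
  collision : ∀ a b → a < b → b ≤ p → (da : Dec (a ≤ h)) (db : Dec (b ≤ h)) → EqMod p (+ value a da) (+ value b db) →
              Σ ℕ λ x → Σ ℕ λ y → EqMod p (+ (α ℕ.* (x ℕ.* x)) + + (β ℕ.* (y ℕ.* y))) (+ c)
  collision a b a<b _ (yes _) (yes b≤h) e = ⊥-elim (squares-distinct pr p≡ a<b b≤h (scaled-cancel {a = a} {b} nα e))
  collision a b a<b _ (no a≰h) (yes b≤h) e = ⊥-elim (a≰h (ℕP.≤-trans (ℕP.<⇒≤ a<b) b≤h))
  collision a b _ _ (yes _) (no _) e =
    a , b ℕ.∸ suc h , eqMod-trans (eqMod-+ e (eqMod-refl {a = + (β ℕ.* ((b ℕ.∸ suc h) ℕ.* (b ℕ.∸ suc h)))})) (cancel-β (b ℕ.∸ suc h))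
  collision a b a<b b≤p (no a≰h) (no _) e =
    ⊥-elim (squares-distinct pr p≡ (ℕP.∸-monoˡ-< a<b (ℕP.≰⇒> a≰h)) b-h-1≤h
              (scaled-cancel {a = a ℕ.∸ suc h} {b ℕ.∸ suc h} nβ′ (eqMod-cancelˡ-+ {c = + c} e)))
    where
    b-h-1≤h : b ℕ.∸ suc h ≤ h
    b-h-1≤h = ℕP.≤-trans (ℕP.∸-monoˡ-≤ (suc h) b≤p) (ℕP.≤-reflexive (trans (cong (ℕ._∸ suc h) p≡) (ℕP.m+n∸m≡n h h)))

record Prime≥7 (p : ℕ) : Set where
  field
    isPrime : Prime p
    half : ℕ
    odd : p ≡ suc (half ℕ.+ half)
    7≤p : 7 ≤ p
open Prime≥7 public

prime≥7⇒nonZero : ∀ {p} → Prime≥7 p → NonZero p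
prime≥7⇒nonZero P = prime⇒nonZero (isPrime P)

<-literal : ∀ m n → {T (m ℕ.<ᵇ n)} → m < n
<-literal m n {t} = ℕP.<ᵇ⇒< m n t

small-nonZeroMod : ∀ {p} → Prime≥7 p → ∀ k → 0 < k → k < 7 → NonZeroMod p (+ k)
small-nonZeroMod P k 0<k k<7 = nonZeroMod-< 0<k (ℕP.<-≤-trans k<7 (7≤p P))

nonZeroMod-1 : ∀ {p} → Prime≥7 p → NonZeroMod p (+ 1)
nonZeroMod-1 P = small-nonZeroMod P 1 (s≤s z≤n) (<-literal 1 7)

half>0 : ∀ {p} (P : Prime≥7 p) → 0 < half P
half>0 P = positive (half P) (subst (7 ≤_) (odd P) (7≤p P))
  where
  positive : ∀ k → 7 ≤ suc (k ℕ.+ k) → 0 < k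
  positive zero (s≤s ())
  positive (suc k) _ = s≤s z≤n

-- Since p ∤ 3 and p ∤ 5, the squares 1 and 4 are neither equal nor opposite,
-- so one of them avoids both δ and -δ.
pick-square : ∀ {p} → Prime≥7 p → ∀ δ →
              Σ ℕ λ s → 0 < s × s < 3 × ¬ EqMod p (+ (s ℕ.* s)) δ × ¬ EqMod p (+ (s ℕ.* s)) (- δ)
pick-square P δ with eqMod? _ (+ 1) δ | eqMod? _ (+ 1) (- δ)
... | no 1≢δ | no 1≢-δ = 1 , s≤s z≤n , s≤s (s≤s z≤n) , 1≢δ , 1≢-δ
... | yes 1≡δ | _ = 2 , s≤s z≤n , s≤s (s≤s (s≤s z≤n)) ,
      (λ e → small-nonZeroMod P 3 (s≤s z≤n) (<-literal 3 7) (zeroMod-of-eqMod (eqMod-trans e (eqMod-sym 1≡δ)))) ,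
      (λ e → small-nonZeroMod P 5 (s≤s z≤n) (<-literal 5 7) (zeroMod-of-eqMod (eqMod-trans e (eqMod-neg (eqMod-sym 1≡δ)))))
... | no _ | yes 1≡-δ = 2 , s≤s z≤n , s≤s (s≤s (s≤s z≤n)) ,
      (λ e → small-nonZeroMod P 5 (s≤s z≤n) (<-literal 5 7)
               (zeroMod-of-eqMod (eqMod-trans e (eqMod-trans (≡⇒eqMod (sym (ℤP.neg-involutive δ))) (eqMod-neg (eqMod-sym 1≡-δ)))))) ,
      (λ e → small-nonZeroMod P 3 (s≤s z≤n) (<-literal 3 7) (zeroMod-of-eqMod (eqMod-trans e (eqMod-sym 1≡-δ))))

-- Diagonal conics

scaledSquare : ℕ → ℕ → ℤ
scaledSquare α X = + (α ℕ.* (X ℕ.* X))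

scaledSquare≡ : ∀ α X → scaledSquare α X ≡ + α * (+ X * + X)
scaledSquare≡ α X = trans (ℤP.pos-* α (X ℕ.* X)) (cong (_*_ (+ α)) (ℤP.pos-* X X))

scaledSquare-zeroMod : ∀ {p} α {X} → ZeroMod p (+ X) → ZeroMod p (scaledSquare α X)
scaledSquare-zeroMod α {X} X≡0 = zeroMod-resp-≡ (sym (scaledSquare≡ α X)) (zeroMod-*ˡ (+ α) (zeroMod-*ˡ (+ X) X≡0))

ConicSolution : ℕ → ℕ → ℕ → ℕ → Set
ConicSolution p α β γ =
  Σ ℕ λ X → Σ ℕ λ Y → Σ ℕ λ Z → NonZeroMod p (+ X) × NonZeroMod p (+ Y) × NonZeroMod p (+ Z) ×
    EqMod p (scaledSquare α X + scaledSquare β Y + scaledSquare γ Z) (+ 0)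

-- At (X, Y, Z) = (2s, y (s² - δ), s² + δ):
-- A X² + B Y² + G Z² = 4 s² (A - B y² δ) + (B y² + G) (s² + δ)².
conic-point : ∀ {p} A B G y s δ → EqMod p (B * (y * y) * δ) A → EqMod p (B * (y * y) + G) (+ 0) →
              EqMod p (A * ((+ 2 * s) * (+ 2 * s)) + B * ((y * (s * s - δ)) * (y * (s * s - δ))) + G * ((s * s + δ) * (s * s + δ))) (+ 0)
conic-point A B G y s δ By²δ≡A By²+G≡0 =
  eqMod-trans (≡⇒eqMod (identity A B G y s δ))
    (eqMod-trans (eqMod-+ (eqMod-* (eqMod-refl {a = + 4 * (s * s)})
                                   (eqMod-trans (eqMod-+ (eqMod-refl {a = A}) (eqMod-neg By²δ≡A)) (≡⇒eqMod (ℤP.+-inverseʳ A))))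
                          (eqMod-* By²+G≡0 (eqMod-refl {a = (s * s + δ) * (s * s + δ)})))
      (≡⇒eqMod (vanish (+ 4 * (s * s)) ((s * s + δ) * (s * s + δ)))))
  where
  identity : ∀ A B G y s δ →
             A * ((+ 2 * s) * (+ 2 * s)) + B * ((y * (s * s - δ)) * (y * (s * s - δ))) + G * ((s * s + δ) * (s * s + δ))
             ≡ (+ 4 * (s * s)) * (A - B * (y * y) * δ) + (B * (y * y) + G) * ((s * s + δ) * (s * s + δ))
  identity = solve-∀
  vanish : ∀ a b → a * + 0 + + 0 * b ≡ + 0
  vanish = solve-∀

-- Starting from the point (0, y₀, 1), take δ = α / (β y₀²) and s² ≢ ±δ, so that
-- the coordinates of conic-point are nonzero.
conic-from-point : ∀ {p} → Prime≥7 p → (α β γ y₀ : ℕ) → NonZeroMod p (+ α) → NonZeroMod p (+ β) → NonZeroMod p (+ y₀) →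
                   EqMod p (scaledSquare β y₀ + + γ) (+ 0) → ConicSolution p α β γ
conic-from-point {p} P α β γ y₀ nα nβ ny₀ on-conic = X , Y , Z , nX , nY , nZ , solution
  where
  instance _ = prime≥7⇒nonZero P
  pr : Prime p
  pr = isPrime P
  A : ℤ
  A = + α
  B : ℤ
  B = + β
  y : ℤ
  y = + y₀
  inv : Σ ℤ λ i → EqMod p (B * (y * y) * i) (+ 1)
  inv = inverse pr (B * (y * y)) (nonZeroMod-* pr nβ (nonZeroMod-* pr ny₀ ny₀))
  δ : ℤ
  δ = A * proj₁ inv
  choice : Σ ℕ λ s → 0 < s × s < 3 × ¬ EqMod p (+ (s ℕ.* s)) δ × ¬ EqMod p (+ (s ℕ.* s)) (- δ)
  choice = pick-square P δ
  s : ℤ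
  s = + proj₁ choice
  s²≡ : + proj₁ choice * + proj₁ choice ≡ + (proj₁ choice ℕ.* proj₁ choice)
  s²≡ = sym (ℤP.pos-* (proj₁ choice) (proj₁ choice))
  s²≢δ : NonZeroMod p (s * s - δ)
  s²≢δ d = proj₁ (proj₂ (proj₂ (proj₂ choice))) (eqMod (subst (λ t → ZeroMod p (t - δ)) s²≡ d))
  s²≢-δ : NonZeroMod p (s * s + δ)
  s²≢-δ d = proj₂ (proj₂ (proj₂ (proj₂ choice))) (eqMod (subst (ZeroMod p) (cong₂ _+_ s²≡ (sym (ℤP.neg-involutive δ))) d))
  X : ℕ
  X = 2 ℕ.* proj₁ choice
  nX : NonZeroMod p (+ X)
  nX = small-nonZeroMod P X (ℕP.<-≤-trans (proj₁ (proj₂ choice)) (ℕP.m≤m+n _ _))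
         (ℕP.≤-<-trans (ℕP.*-monoʳ-≤ 2 (ℕP.≤-pred (proj₁ (proj₂ (proj₂ choice))))) (<-literal 4 7))
  rY : Σ ℕ λ w → EqMod p (+ w) (y * (s * s - δ))
  rY = representative p (y * (s * s - δ))
  rZ : Σ ℕ λ w → EqMod p (+ w) (s * s + δ)
  rZ = representative p (s * s + δ)
  Y : ℕ
  Y = proj₁ rY
  Z : ℕ
  Z = proj₁ rZ
  nY : NonZeroMod p (+ Y)
  nY d = nonZeroMod-* pr ny₀ s²≢δ (zeroMod-respˡ (eqMod-sym (proj₂ rY)) d)
  nZ : NonZeroMod p (+ Z)
  nZ d = s²≢-δ (zeroMod-respˡ (eqMod-sym (proj₂ rZ)) d)
  By²δ≡A : EqMod p (B * (y * y) * δ) A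
  By²δ≡A = eqMod-trans (≡⇒eqMod (reassoc (B * (y * y)) A (proj₁ inv)))
             (eqMod-trans (eqMod-* (proj₂ inv) (eqMod-refl {a = A})) (≡⇒eqMod (ℤP.*-identityˡ A)))
    where
    reassoc : ∀ u a i → u * (a * i) ≡ (u * i) * a
    reassoc = solve-∀
  solution : EqMod p (scaledSquare α X + scaledSquare β Y + scaledSquare γ Z) (+ 0)
  solution =
    eqMod-trans (≡⇒eqMod (cong₂ _+_ (cong₂ _+_ (trans (scaledSquare≡ α X) (cong (λ t → A * (t * t)) (ℤP.pos-* 2 (proj₁ choice))))
                                               (scaledSquare≡ β Y))
                                    (scaledSquare≡ γ Z)))
      (eqMod-trans (eqMod-+ (eqMod-+ (eqMod-refl {a = A * ((+ 2 * s) * (+ 2 * s))})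
                                     (eqMod-* (eqMod-refl {a = B}) (eqMod-* (proj₂ rY) (proj₂ rY))))
                            (eqMod-* (eqMod-refl {a = + γ}) (eqMod-* (proj₂ rZ) (proj₂ rZ))))
        (conic-point A B (+ γ) y s δ By²δ≡A (eqMod-trans (≡⇒eqMod (cong (_+ + γ) (sym (scaledSquare≡ β y₀)))) on-conic)))

-- A representation α x² + β y² ≡ -γ is already a solution with Z = 1 unless
-- x or y vanishes, in which case it is a point from which to start.
conic-from-representation : ∀ {p} → Prime≥7 p → (α β γ : ℕ) → NonZeroMod p (+ α) → NonZeroMod p (+ β) → NonZeroMod p (+ γ) →
                            (x y : ℕ) → EqMod p (scaledSquare α x + scaledSquare β y + + γ) (+ 0) → ConicSolution p α β γ
conic-from-representation {p} P α β γ nα nβ nγ x y on-conic with zeroMod? p (+ x) | zeroMod? p (+ y)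
... | yes x≡0 | _ = conic-from-point P α β γ y nα nβ ny on-axis
  where
  on-axis : EqMod p (scaledSquare β y + + γ) (+ 0)
  on-axis = drop-zero-term (scaledSquare α x) (scaledSquare β y + + γ) (scaledSquare-zeroMod α x≡0)
              (eqMod-trans (≡⇒eqMod (sym (ℤP.+-assoc (scaledSquare α x) (scaledSquare β y) (+ γ)))) on-conic)
  ny : NonZeroMod p (+ y)
  ny y≡0 = nγ (eqMod0⇒zeroMod (drop-zero-term (scaledSquare β y) (+ γ) (scaledSquare-zeroMod β y≡0) on-axis))
... | no nx | yes y≡0 = swap-coefficients (conic-from-point P β α γ x nβ nα nx on-axis)
  where
  on-axis : EqMod p (scaledSquare α x + + γ) (+ 0)
  on-axis = drop-zero-term (scaledSquare β y) (scaledSquare α x + + γ) (scaledSquare-zeroMod β y≡0)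
              (eqMod-trans (≡⇒eqMod (regroup (scaledSquare α x) (scaledSquare β y) (+ γ))) on-conic)
    where
    regroup : ∀ a b c → b + (a + c) ≡ a + b + c
    regroup = solve-∀
  swap-coefficients : ConicSolution p β α γ → ConicSolution p α β γ
  swap-coefficients (X , Y , Z , nX , nY , nZ , e) =
    Y , X , Z , nY , nX , nZ , eqMod-trans (≡⇒eqMod (cong (_+ scaledSquare γ Z) (ℤP.+-comm (scaledSquare α Y) (scaledSquare β X)))) e
... | no nx | no ny =
  x , y , 1 , nx , ny , nonZeroMod-1 P ,
  eqMod-trans (≡⇒eqMod (cong (λ t → scaledSquare α x + scaledSquare β y + + t) (ℕP.*-identityʳ γ))) on-conic

conic-solvable : ∀ {p} → Prime≥7 p → (α β γ : ℕ) → NonZeroMod p (+ α) → NonZeroMod p (+ β) → NonZeroMod p (+ γ) →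
                 ConicSolution p α β γ
conic-solvable {p} P α β γ nα nβ nγ =
  let instance _ = prime≥7⇒nonZero P
      γ′ , γ′≡-γ = representative p (- + γ)
      x , y , represents = diagonal-form-represents {h = half P} (isPrime P) (odd P) α β γ′ nα nβ
  in conic-from-representation P α β γ nα nβ nγ x y
       (eqMod-trans (eqMod-+ represents (eqMod-refl {a = + γ}))
                    (eqMod-trans (eqMod-+ γ′≡-γ (eqMod-refl {a = + γ})) (≡⇒eqMod (ℤP.+-inverseˡ (+ γ)))))

-- Weights with a prescribed Legendre symbol

Weight : ℕ → ℕ → Sign → Set
Weight p b s = NonZeroMod p (+ b) × Leg p b s

weight-of-sign : ∀ {p} → Prime≥7 p → (s : Sign) → Σ ℕ λ e → Weight p e s
weight-of-sign P Sg.+ = 1 , nonZeroMod-1 P , leg-square 1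
weight-of-sign P Sg.- =
  let c , nc , ¬qr = nonResidue {h = half P} (isPrime P) (odd P) (half>0 P) in c , nc , leg-nqr ¬qr

weight-of : ∀ {p} → Prime≥7 p → ∀ c → NonZeroMod p (+ c) → Σ Sign (Weight p c)
weight-of {p} P c nc = let s , leg = legendre p {{prime≥7⇒nonZero P}} c in s , nc , leg

weight-1 : ∀ {p} → Prime≥7 p → Weight p 1 Sg.+
weight-1 P = nonZeroMod-1 P , leg-square 1

weight-square : ∀ {p} → Prime p → ∀ X → NonZeroMod p (+ X) → Weight p (X ℕ.* X) Sg.+
weight-square pr X nX = nonZeroMod-*ℕ pr nX nX , leg-square X

solve-linear : ∀ {p} → Prime p → ∀ t v → NonZeroMod p (+ t) → NonZeroMod p v →
               Σ ℕ λ b → NonZeroMod p (+ b) × EqMod p (+ (b ℕ.* t) + v) (+ 0)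
solve-linear {p} pr t v nt nv =
  let instance _ = prime⇒nonZero pr
      i , ti≡1 = inverse pr (+ t) nt
      b , b≡-vi = representative p (- v * i)
      nb : NonZeroMod p (+ b)
      nb b≡0 = nonZeroMod-* pr (λ -v≡0 → nv (zeroMod-resp-≡ (ℤP.neg-involutive v) (zeroMod-neg -v≡0)))
                 (λ i≡0 → p∤1 (zeroMod-respˡ (eqMod-sym ti≡1) (zeroMod-*ˡ (+ t) i≡0)))
                 (zeroMod-respˡ (eqMod-sym b≡-vi) b≡0)
  in b , nb ,
     eqMod-trans (≡⇒eqMod (cong (_+ v) (ℤP.pos-* b t)))
       (eqMod-trans (eqMod-+ (eqMod-* b≡-vi (eqMod-refl {a = + t})) (eqMod-refl {a = v}))
         (eqMod-trans (≡⇒eqMod (reassoc v i (+ t)))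
           (eqMod-trans (eqMod-+ (eqMod-* (eqMod-refl {a = - v}) ti≡1) (eqMod-refl {a = v})) (≡⇒eqMod (cancel v)))))
  where
  p∤1 : NonZeroMod p (+ 1)
  p∤1 (zeroMod p∣1) = prime≢1 pr (ℕD.∣1⇒≡1 p∣1)
  reassoc : ∀ v i t → - v * i * t + v ≡ - v * (t * i) + v
  reassoc = solve-∀
  cancel : ∀ v → - v * + 1 + v ≡ + 0
  cancel = solve-∀

isQR-*square : ∀ {p} k {a} → IsQR p a → IsQR p (k ℕ.* k ℕ.* a)
isQR-*square {p} k {a} (y , y²≡a) =
  k ℕ.* y ,
  eqMod⇒∣ (eqMod-trans (≡⇒eqMod (trans (cong +_ (regroup k y)) (ℤP.pos-* (k ℕ.* k) (y ℕ.* y))))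
             (eqMod-trans (eqMod-* (eqMod-refl {a = + (k ℕ.* k)}) (∣⇒eqMod {p} {+ (y ℕ.* y)} {+ a} y²≡a))
               (≡⇒eqMod (sym (ℤP.pos-* (k ℕ.* k) a)))))
  where
  regroup : ∀ k y → (k ℕ.* y) ℕ.* (k ℕ.* y) ≡ (k ℕ.* k) ℕ.* (y ℕ.* y)
  regroup = NS.solve-∀

weight-*4 : ∀ {p} → Prime≥7 p → ∀ {e s} → Weight p e s → Weight p (4 ℕ.* e) s
weight-*4 {p} P {e} (ne , lg) = n4e , leg-*4 lg
  where
  instance _ = prime≥7⇒nonZero P
  n4e : NonZeroMod p (+ (4 ℕ.* e))
  n4e = nonZeroMod-*ℕ (isPrime P) (small-nonZeroMod P 4 (s≤s z≤n) (<-literal 4 7)) ne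
  half-of-4 : Σ ℕ λ w → EqMod p (+ (w ℕ.* w ℕ.* (4 ℕ.* e))) (+ e)
  half-of-4 =
    let i , 2i≡1 = inverse (isPrime P) (+ 2) (small-nonZeroMod P 2 (s≤s z≤n) (<-literal 2 7))
        w , w≡i = representative p i
        2w≡1 : EqMod p (+ (2 ℕ.* w)) (+ 1)
        2w≡1 = eqMod-trans (≡⇒eqMod (ℤP.pos-* 2 w)) (eqMod-trans (eqMod-* (eqMod-refl {a = + 2}) w≡i) 2i≡1)
    in w , eqMod-trans (≡⇒eqMod (trans (cong +_ (regroup w e)) (ℤP.pos-* ((2 ℕ.* w) ℕ.* (2 ℕ.* w)) e)))
             (eqMod-trans (eqMod-* (square-eqMod 2w≡1) (eqMod-refl {a = + e})) (≡⇒eqMod (ℤP.*-identityˡ (+ e))))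
    where
    regroup : ∀ w e → w ℕ.* w ℕ.* (4 ℕ.* e) ≡ (2 ℕ.* w) ℕ.* (2 ℕ.* w) ℕ.* e
    regroup = NS.solve-∀
  leg-*4 : ∀ {s} → Leg p e s → Leg p (4 ℕ.* e) s
  leg-*4 (leg-qr qr) = leg-qr (isQR-*square 2 {e} qr)
  leg-*4 (leg-nqr ¬qr) = leg-nqr λ qr → ¬qr (isQR-resp (proj₂ half-of-4) (isQR-*square (proj₁ half-of-4) qr))

-- If e₁ t₁ + e₂ t₂ ≡ 0, then e₁ t₁ + 4 e₂ t₂ ≡ 3 e₂ t₂ ≢ 0.
avoid-zero-sum : ∀ {p} → Prime≥7 p → ∀ e₁ t₁ e₂ t₂ → NonZeroMod p (+ e₂) → NonZeroMod p (+ t₂) →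
                 Σ ℕ λ b → (b ≡ e₂ ⊎ b ≡ 4 ℕ.* e₂) × NonZeroMod p (+ (e₁ ℕ.* t₁) + + (b ℕ.* t₂))
avoid-zero-sum {p} P e₁ t₁ e₂ t₂ ne₂ nt₂ with zeroMod? p (+ (e₁ ℕ.* t₁) + + (e₂ ℕ.* t₂))
... | no sum≢0 = e₂ , inj₁ refl , sum≢0
... | yes sum≡0 = 4 ℕ.* e₂ , inj₂ refl , λ sum′≡0 → 3e₂t₂≢0 (zeroMod-resp-≡ difference (zeroMod-+ (zeroMod-neg sum≡0) sum′≡0))
  where
  pr : Prime p
  pr = isPrime P
  3e₂t₂≢0 : NonZeroMod p (+ 3 * (+ e₂ * + t₂))
  3e₂t₂≢0 = nonZeroMod-* pr (small-nonZeroMod P 3 (s≤s z≤n) (<-literal 3 7)) (nonZeroMod-* pr ne₂ nt₂)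
  identity : ∀ a e t → - (a + e * t) + (a + (+ 4 * e) * t) ≡ + 3 * (e * t)
  identity = solve-∀
  difference : - (+ (e₁ ℕ.* t₁) + + (e₂ ℕ.* t₂)) + (+ (e₁ ℕ.* t₁) + + (4 ℕ.* e₂ ℕ.* t₂)) ≡ + 3 * (+ e₂ * + t₂)
  difference =
    trans (cong₂ (λ u v → - (+ (e₁ ℕ.* t₁) + u) + (+ (e₁ ℕ.* t₁) + v))
                 (ℤP.pos-* e₂ t₂) (trans (ℤP.pos-* (4 ℕ.* e₂) t₂) (cong (_* + t₂) (ℤP.pos-* 4 e₂))))
          (identity (+ (e₁ ℕ.* t₁)) (+ e₂) (+ t₂))

-- Zero-sums of three terms modulo two primes

keep : Bool → ℕ → ℕ
keep true x = x
keep false x = 0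

sum3 : Bool → Bool → Bool → ℕ → ℕ → ℕ → ℕ
sum3 f₀ f₁ f₂ a₀ a₁ a₂ = keep f₀ a₀ ℕ.+ keep f₁ a₁ ℕ.+ keep f₂ a₂

MatchedWeights : ℕ → ℕ → ℕ → ℕ → Set
MatchedWeights q r c d = Σ Sign λ s → Weight q c s × Weight r d s

-- The reductions mod q and mod r of an S(qr)-weighted zero-sum subsequence of
-- (v₀, v₁, v₂): the flags select the subsequence, and matching Legendre symbols
-- make the CRT lift of each pair of weights have Jacobi symbol +1.
record MatchedZeroSum (q r v₀ v₁ v₂ : ℕ) : Set where
  constructor mkMatched
  field
    f₀ f₁ f₂ : Bool
    nonempty : T (f₀ ∨ f₁ ∨ f₂)
    c₀ c₁ c₂ d₀ d₁ d₂ : ℕ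
    w₀ : T f₀ → MatchedWeights q r c₀ d₀
    w₁ : T f₁ → MatchedWeights q r c₁ d₁
    w₂ : T f₂ → MatchedWeights q r c₂ d₂
    zero-q : q ∣ sum3 f₀ f₁ f₂ (c₀ ℕ.* v₀) (c₁ ℕ.* v₁) (c₂ ℕ.* v₂)
    zero-r : r ∣ sum3 f₀ f₁ f₂ (d₀ ℕ.* v₀) (d₁ ℕ.* v₁) (d₂ ℕ.* v₂)

-- Adding weights b_i ≢ 0 mod p that also sum to zero gives an L(pqr; p)-weighted
-- zero-sum: the Jacobi symbol of the lift is (b/p) · s², i.e. (b/p).
record LZeroSum (p q r v₀ v₁ v₂ : ℕ) : Set where
  constructor mkL
  field
    matched : MatchedZeroSum q r v₀ v₁ v₂
    b₀ b₁ b₂ : ℕ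
    nb₀ : NonZeroMod p (+ b₀)
    nb₁ : NonZeroMod p (+ b₁)
    nb₂ : NonZeroMod p (+ b₂)
    zero-p : p ∣ sum3 (MatchedZeroSum.f₀ matched) (MatchedZeroSum.f₁ matched) (MatchedZeroSum.f₂ matched)
                      (b₀ ℕ.* v₀) (b₁ ℕ.* v₁) (b₂ ℕ.* v₂)

sum3-swap01 : ∀ {p} f₀ f₁ f₂ a₀ a₁ a₂ → p ∣ sum3 f₀ f₁ f₂ a₀ a₁ a₂ → p ∣ sum3 f₁ f₀ f₂ a₁ a₀ a₂
sum3-swap01 {p} f₀ f₁ f₂ a₀ a₁ a₂ = subst (p ∣_) (cong (ℕ._+ keep f₂ a₂) (ℕP.+-comm (keep f₀ a₀) (keep f₁ a₁)))

sum3-swap12 : ∀ {p} f₀ f₁ f₂ a₀ a₁ a₂ → p ∣ sum3 f₀ f₁ f₂ a₀ a₁ a₂ → p ∣ sum3 f₀ f₂ f₁ a₀ a₂ a₁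
sum3-swap12 {p} f₀ f₁ f₂ a₀ a₁ a₂ = subst (p ∣_) (swap-last (keep f₀ a₀) (keep f₁ a₁) (keep f₂ a₂))
  where
  swap-last : ∀ a b c → a ℕ.+ b ℕ.+ c ≡ a ℕ.+ c ℕ.+ b
  swap-last = NS.solve-∀

any3-swap01 : ∀ f₀ f₁ f₂ → T (f₀ ∨ f₁ ∨ f₂) → T (f₁ ∨ f₀ ∨ f₂)
any3-swap01 true true _ t = t
any3-swap01 true false _ t = t
any3-swap01 false true _ t = t
any3-swap01 false false _ t = t

any3-swap12 : ∀ f₀ f₁ f₂ → T (f₀ ∨ f₁ ∨ f₂) → T (f₀ ∨ f₂ ∨ f₁)
any3-swap12 true _ _ t = tt
any3-swap12 false true true t = tt
any3-swap12 false true false t = tt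
any3-swap12 false false true t = tt
any3-swap12 false false false t = t

matched-swap01 : ∀ {q r v₀ v₁ v₂} → MatchedZeroSum q r v₀ v₁ v₂ → MatchedZeroSum q r v₁ v₀ v₂
matched-swap01 (mkMatched f₀ f₁ f₂ ne c₀ c₁ c₂ d₀ d₁ d₂ w₀ w₁ w₂ zq zr) =
  mkMatched f₁ f₀ f₂ (any3-swap01 f₀ f₁ f₂ ne) c₁ c₀ c₂ d₁ d₀ d₂ w₁ w₀ w₂
            (sum3-swap01 f₀ f₁ f₂ _ _ _ zq) (sum3-swap01 f₀ f₁ f₂ _ _ _ zr)

matched-swap12 : ∀ {q r v₀ v₁ v₂} → MatchedZeroSum q r v₀ v₁ v₂ → MatchedZeroSum q r v₀ v₂ v₁
matched-swap12 (mkMatched f₀ f₁ f₂ ne c₀ c₁ c₂ d₀ d₁ d₂ w₀ w₁ w₂ zq zr) =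
  mkMatched f₀ f₂ f₁ (any3-swap12 f₀ f₁ f₂ ne) c₀ c₂ c₁ d₀ d₂ d₁ w₀ w₂ w₁
            (sum3-swap12 f₀ f₁ f₂ _ _ _ zq) (sum3-swap12 f₀ f₁ f₂ _ _ _ zr)

matched-swap02 : ∀ {q r v₀ v₁ v₂} → MatchedZeroSum q r v₀ v₁ v₂ → MatchedZeroSum q r v₂ v₁ v₀
matched-swap02 m = matched-swap01 (matched-swap12 (matched-swap01 m))

matched-swapPrimes : ∀ {q r v₀ v₁ v₂} → MatchedZeroSum q r v₀ v₁ v₂ → MatchedZeroSum r q v₀ v₁ v₂
matched-swapPrimes (mkMatched f₀ f₁ f₂ ne c₀ c₁ c₂ d₀ d₁ d₂ w₀ w₁ w₂ zq zr) =
  mkMatched f₀ f₁ f₂ ne d₀ d₁ d₂ c₀ c₁ c₂ (flip ∘ w₀) (flip ∘ w₁) (flip ∘ w₂) zr zq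
  where
  flip : ∀ {q r c d} → MatchedWeights q r c d → MatchedWeights r q d c
  flip (s , wc , wd) = s , wd , wc

lzs-swap01 : ∀ {p q r v₀ v₁ v₂} → LZeroSum p q r v₀ v₁ v₂ → LZeroSum p q r v₁ v₀ v₂
lzs-swap01 (mkL m b₀ b₁ b₂ n₀ n₁ n₂ zp) =
  mkL (matched-swap01 m) b₁ b₀ b₂ n₁ n₀ n₂ (sum3-swap01 (MatchedZeroSum.f₀ m) (MatchedZeroSum.f₁ m) (MatchedZeroSum.f₂ m) _ _ _ zp)

lzs-swap12 : ∀ {p q r v₀ v₁ v₂} → LZeroSum p q r v₀ v₁ v₂ → LZeroSum p q r v₀ v₂ v₁
lzs-swap12 (mkL m b₀ b₁ b₂ n₀ n₁ n₂ zp) =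
  mkL (matched-swap12 m) b₀ b₂ b₁ n₀ n₂ n₁ (sum3-swap12 (MatchedZeroSum.f₀ m) (MatchedZeroSum.f₁ m) (MatchedZeroSum.f₂ m) _ _ _ zp)

lzs-swap02 : ∀ {p q r v₀ v₁ v₂} → LZeroSum p q r v₀ v₁ v₂ → LZeroSum p q r v₂ v₁ v₀
lzs-swap02 l = lzs-swap01 (lzs-swap12 (lzs-swap01 l))

lzs-rotate : ∀ {p q r v₀ v₁ v₂} → LZeroSum p q r v₁ v₂ v₀ → LZeroSum p q r v₀ v₁ v₂
lzs-rotate l = lzs-swap02 (lzs-swap01 l)

eqMod0⇒∣ : ∀ {p s} → EqMod p (+ s) (+ 0) → p ∣ s
eqMod0⇒∣ e = ∣-of-zeroMod (eqMod0⇒zeroMod e)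

zeroMod⇒*-eqMod0 : ∀ {p v} → ZeroMod p (+ v) → ∀ c → EqMod p (+ (c ℕ.* v)) (+ 0)
zeroMod⇒*-eqMod0 {p} {v} v≡0 c = zeroMod⇒eqMod0 (zeroMod-resp-≡ (sym (ℤP.pos-* c v)) (zeroMod-*ˡ (+ c) v≡0))

module _ {p : ℕ} where
  eqMod0-+₃ : ∀ {a b c} → EqMod p a (+ 0) → EqMod p b (+ 0) → EqMod p c (+ 0) → EqMod p (a + b + c) (+ 0)
  eqMod0-+₃ a≡0 b≡0 c≡0 = eqMod-+ (eqMod-+ a≡0 b≡0) c≡0

  eqMod0-+₃ᵐ : ∀ {a b c} → EqMod p (a + c) (+ 0) → EqMod p b (+ 0) → EqMod p (a + b + c) (+ 0)
  eqMod0-+₃ᵐ {a} {b} {c} ac≡0 b≡0 = eqMod-trans (≡⇒eqMod (regroup a b c)) (eqMod-+ ac≡0 b≡0)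
    where
    regroup : ∀ a b c → a + b + c ≡ (a + c) + b
    regroup = solve-∀

  eqMod0-+₃ˡ : ∀ {a b c} → EqMod p a (+ 0) → EqMod p (b + c) (+ 0) → EqMod p (a + b + c) (+ 0)
  eqMod0-+₃ˡ {a} {b} {c} a≡0 bc≡0 = eqMod-trans (≡⇒eqMod (ℤP.+-assoc a b c)) (eqMod-+ a≡0 bc≡0)

  eqMod0-comm : ∀ {a b} → EqMod p (a + b) (+ 0) → EqMod p (b + a) (+ 0)
  eqMod0-comm {a} {b} = eqMod-trans (≡⇒eqMod (ℤP.+-comm b a))

data Residue (q r v : ℕ) : Set where
  vanishing : ZeroMod q (+ v) → ZeroMod r (+ v) → Residue q r v
  onlyAtQ : NonZeroMod q (+ v) → ZeroMod r (+ v) → Residue q r v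
  onlyAtR : ZeroMod q (+ v) → NonZeroMod r (+ v) → Residue q r v
  nowhereZero : NonZeroMod q (+ v) → NonZeroMod r (+ v) → Residue q r v

classify : ∀ q r v → Residue q r v
classify q r v with zeroMod? q (+ v) | zeroMod? r (+ v)
... | yes a | yes b = vanishing a b
... | no a | yes b = onlyAtQ a b
... | yes a | no b = onlyAtR a b
... | no a | no b = nowhereZero a b

matched-weights : ∀ {q r c} → Prime≥7 q → Prime≥7 r → NonZeroMod q (+ c) → Σ ℕ (MatchedWeights q r c)
matched-weights {c = c} Q R nc =
  let s , w = weight-of Q c nc
      d , w′ = weight-of-sign R s
  in d , s , w , w′

module MatchedCases {q r : ℕ} (Q : Prime≥7 q) (R : Prime≥7 r) where
  matched-1 : MatchedWeights q r 1 1
  matched-1 = Sg.+ , weight-1 Q , weight-1 R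

  single : ∀ {v₀ v₁ v₂} → ZeroMod q (+ v₀) → ZeroMod r (+ v₀) → MatchedZeroSum q r v₀ v₁ v₂
  single a b =
    mkMatched true false false tt 1 0 0 1 0 0 (λ _ → matched-1) (λ ()) (λ ())
      (eqMod0⇒∣ (eqMod0-+₃ (zeroMod⇒*-eqMod0 a 1) eqMod-refl eqMod-refl))
      (eqMod0⇒∣ (eqMod0-+₃ (zeroMod⇒*-eqMod0 b 1) eqMod-refl eqMod-refl))

  twoAtQ : ∀ {v₀ v₁ v₂} → NonZeroMod q (+ v₀) → ZeroMod r (+ v₀) → NonZeroMod q (+ v₁) → ZeroMod r (+ v₁) →
           MatchedZeroSum q r v₀ v₁ v₂
  twoAtQ {v₀} {v₁} nq₀ zr₀ nq₁ zr₁ =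
    let c₁ , nc₁ , zq = solve-linear (isPrime Q) v₁ (+ (1 ℕ.* v₀)) nq₁ (nonZeroMod-*ℕ (isPrime Q) (nonZeroMod-1 Q) nq₀)
        d₁ , w₁ = matched-weights Q R nc₁
    in mkMatched true true false tt 1 c₁ 0 1 d₁ 0 (λ _ → matched-1) (λ _ → w₁) (λ ())
         (eqMod0⇒∣ (eqMod-+ (eqMod0-comm {a = + (c₁ ℕ.* v₁)} {+ (1 ℕ.* v₀)} zq) (eqMod-refl {a = + 0})))
         (eqMod0⇒∣ (eqMod0-+₃ (zeroMod⇒*-eqMod0 zr₀ 1) (zeroMod⇒*-eqMod0 zr₁ d₁) eqMod-refl))

  case-QRF : ∀ {v₀ v₁ v₂} → NonZeroMod q (+ v₀) → ZeroMod r (+ v₀) → ZeroMod q (+ v₁) → NonZeroMod r (+ v₁) →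
             NonZeroMod q (+ v₂) → NonZeroMod r (+ v₂) → MatchedZeroSum q r v₀ v₁ v₂
  case-QRF {v₀} {v₁} {v₂} nq₀ zr₀ zq₁ nr₁ nq₂ nr₂ =
    let c₀ , nc₀ , zq = solve-linear (isPrime Q) v₀ (+ (1 ℕ.* v₂)) nq₀ (nonZeroMod-*ℕ (isPrime Q) (nonZeroMod-1 Q) nq₂)
        d₁ , nd₁ , zr = solve-linear (isPrime R) v₁ (+ (1 ℕ.* v₂)) nr₁ (nonZeroMod-*ℕ (isPrime R) (nonZeroMod-1 R) nr₂)
        d₀ , w₀ = matched-weights Q R nc₀
        c₁ , s₁ , w′ , w = matched-weights R Q nd₁
    in mkMatched true true true tt c₀ c₁ 1 d₀ d₁ 1 (λ _ → w₀) (λ _ → s₁ , w , w′) (λ _ → matched-1)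
         (eqMod0⇒∣ (eqMod0-+₃ᵐ {a = + (c₀ ℕ.* v₀)} {+ (c₁ ℕ.* v₁)} {+ (1 ℕ.* v₂)} zq (zeroMod⇒*-eqMod0 zq₁ c₁)))
         (eqMod0⇒∣ (eqMod0-+₃ˡ {b = + (d₁ ℕ.* v₁)} {c = + (1 ℕ.* v₂)} (zeroMod⇒*-eqMod0 zr₀ d₀) zr))

  case-QFF : ∀ {v₀ v₁ v₂} → NonZeroMod q (+ v₀) → ZeroMod r (+ v₀) → NonZeroMod q (+ v₁) → NonZeroMod r (+ v₁) →
             NonZeroMod q (+ v₂) → NonZeroMod r (+ v₂) → MatchedZeroSum q r v₀ v₁ v₂
  case-QFF {v₀} {v₁} {v₂} nq₀ zr₀ nq₁ nr₁ nq₂ nr₂ =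
    let d₂ , nd₂ , zr = solve-linear (isPrime R) v₂ (+ (1 ℕ.* v₁)) nr₂ (nonZeroMod-*ℕ (isPrime R) (nonZeroMod-1 R) nr₁)
        σ , wd₂ = weight-of R d₂ nd₂
        e₂ , we₂ = weight-of-sign Q σ
        c₂ , c₂≡ , nsum = avoid-zero-sum Q 1 v₁ e₂ v₂ (proj₁ we₂) nq₂
        wc₂ : Weight q c₂ σ
        wc₂ = [ (λ e → subst (λ t → Weight q t σ) (sym e) we₂) , (λ e → subst (λ t → Weight q t σ) (sym e) (weight-*4 Q we₂)) ]′ c₂≡
        c₀ , nc₀ , zq = solve-linear (isPrime Q) v₀ (+ (1 ℕ.* v₁) + + (c₂ ℕ.* v₂)) nq₀ nsum
        d₀ , w₀ = matched-weights Q R nc₀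
    in mkMatched true true true tt c₀ 1 c₂ d₀ 1 d₂ (λ _ → w₀) (λ _ → matched-1) (λ _ → σ , wc₂ , wd₂)
         (eqMod0⇒∣ (eqMod-trans (≡⇒eqMod (ℤP.+-assoc (+ (c₀ ℕ.* v₀)) (+ (1 ℕ.* v₁)) (+ (c₂ ℕ.* v₂)))) zq))
         (eqMod0⇒∣ (eqMod0-+₃ˡ {b = + (1 ℕ.* v₁)} {c = + (d₂ ℕ.* v₂)} (zeroMod⇒*-eqMod0 zr₀ d₀)
                                (eqMod0-comm {a = + (d₂ ℕ.* v₂)} {+ (1 ℕ.* v₁)} zr)))

  case-FFF : ∀ {v₀ v₁ v₂} → NonZeroMod q (+ v₀) → NonZeroMod r (+ v₀) → NonZeroMod q (+ v₁) → NonZeroMod r (+ v₁) →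
             NonZeroMod q (+ v₂) → NonZeroMod r (+ v₂) → MatchedZeroSum q r v₀ v₁ v₂
  case-FFF {v₀} {v₁} {v₂} nq₀ nr₀ nq₁ nr₁ nq₂ nr₂ =
    let X , Y , Z , nX , nY , nZ , zq = conic-solvable Q v₀ v₁ v₂ nq₀ nq₁ nq₂
        X′ , Y′ , Z′ , nX′ , nY′ , nZ′ , zr = conic-solvable R v₀ v₁ v₂ nr₀ nr₁ nr₂
    in mkMatched true true true tt (X ℕ.* X) (Y ℕ.* Y) (Z ℕ.* Z) (X′ ℕ.* X′) (Y′ ℕ.* Y′) (Z′ ℕ.* Z′)
         (λ _ → Sg.+ , weight-square (isPrime Q) X nX , weight-square (isPrime R) X′ nX′)
         (λ _ → Sg.+ , weight-square (isPrime Q) Y nY , weight-square (isPrime R) Y′ nY′)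
         (λ _ → Sg.+ , weight-square (isPrime Q) Z nZ , weight-square (isPrime R) Z′ nZ′)
         (eqMod0⇒∣ (eqMod-trans (≡⇒eqMod (cong₂ _+_ (cong₂ _+_ (commute X v₀) (commute Y v₁)) (commute Z v₂))) zq))
         (eqMod0⇒∣ (eqMod-trans (≡⇒eqMod (cong₂ _+_ (cong₂ _+_ (commute X′ v₀) (commute Y′ v₁)) (commute Z′ v₂))) zr))
    where
    commute : ∀ X v → + ((X ℕ.* X) ℕ.* v) ≡ scaledSquare v X
    commute X v = cong +_ (ℕP.*-comm (X ℕ.* X) v)

-- Up to the symmetries (permuting the terms, exchanging q and r) the cases above
-- cover every combination of residue classes.
matchedZeroSum′ : ∀ {q r v₀ v₁ v₂} → Prime≥7 q → Prime≥7 r → Residue q r v₀ → Residue q r v₁ → Residue q r v₂ →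
                  MatchedZeroSum q r v₀ v₁ v₂
matchedZeroSum′ Q R = cases
  where
  module CQ = MatchedCases Q R
  module CR = MatchedCases R Q
  rotate : ∀ {v₀ v₁ v₂} → MatchedZeroSum _ _ v₁ v₂ v₀ → MatchedZeroSum _ _ v₀ v₁ v₂
  rotate m = matched-swap02 (matched-swap01 m)
  rotate⁻¹ : ∀ {v₀ v₁ v₂} → MatchedZeroSum _ _ v₂ v₀ v₁ → MatchedZeroSum _ _ v₀ v₁ v₂
  rotate⁻¹ m = matched-swap12 (matched-swap01 m)
  cases : ∀ {v₀ v₁ v₂} → Residue _ _ v₀ → Residue _ _ v₁ → Residue _ _ v₂ → MatchedZeroSum _ _ v₀ v₁ v₂
  cases (vanishing a b) _ _ = CQ.single a b
  cases _ (vanishing a b) _ = matched-swap01 (CQ.single a b)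
  cases _ _ (vanishing a b) = matched-swap02 (CQ.single a b)
  cases (onlyAtQ a b) (onlyAtQ c d) _ = CQ.twoAtQ a b c d
  cases (onlyAtQ a b) _ (onlyAtQ c d) = matched-swap12 (CQ.twoAtQ a b c d)
  cases _ (onlyAtQ a b) (onlyAtQ c d) = matched-swap02 (CQ.twoAtQ c d a b)
  cases (onlyAtR a b) (onlyAtR c d) _ = matched-swapPrimes (CR.twoAtQ b a d c)
  cases (onlyAtR a b) _ (onlyAtR c d) = matched-swapPrimes (matched-swap12 (CR.twoAtQ b a d c))
  cases _ (onlyAtR a b) (onlyAtR c d) = matched-swapPrimes (matched-swap02 (CR.twoAtQ d c b a))
  cases (onlyAtQ a b) (onlyAtR c d) (nowhereZero e f) = CQ.case-QRF a b c d e f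
  cases (onlyAtQ a b) (nowhereZero e f) (onlyAtR c d) = matched-swap12 (CQ.case-QRF a b c d e f)
  cases (onlyAtR c d) (onlyAtQ a b) (nowhereZero e f) = matched-swap01 (CQ.case-QRF a b c d e f)
  cases (onlyAtR c d) (nowhereZero e f) (onlyAtQ a b) = rotate⁻¹ (CQ.case-QRF a b c d e f)
  cases (nowhereZero e f) (onlyAtQ a b) (onlyAtR c d) = rotate (CQ.case-QRF a b c d e f)
  cases (nowhereZero e f) (onlyAtR c d) (onlyAtQ a b) = matched-swap02 (CQ.case-QRF a b c d e f)
  cases (onlyAtQ a b) (nowhereZero c d) (nowhereZero e f) = CQ.case-QFF a b c d e f
  cases (nowhereZero c d) (onlyAtQ a b) (nowhereZero e f) = matched-swap01 (CQ.case-QFF a b c d e f)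
  cases (nowhereZero c d) (nowhereZero e f) (onlyAtQ a b) = matched-swap02 (CQ.case-QFF a b e f c d)
  cases (onlyAtR a b) (nowhereZero c d) (nowhereZero e f) = matched-swapPrimes (CR.case-QFF b a d c f e)
  cases (nowhereZero c d) (onlyAtR a b) (nowhereZero e f) = matched-swapPrimes (matched-swap01 (CR.case-QFF b a d c f e))
  cases (nowhereZero c d) (nowhereZero e f) (onlyAtR a b) = matched-swapPrimes (matched-swap02 (CR.case-QFF b a f e d c))
  cases (nowhereZero a b) (nowhereZero c d) (nowhereZero e f) = CQ.case-FFF a b c d e f

matchedZeroSum : ∀ {q r} → Prime≥7 q → Prime≥7 r → ∀ v₀ v₁ v₂ → MatchedZeroSum q r v₀ v₁ v₂
matchedZeroSum {q} {r} Q R v₀ v₁ v₂ = matchedZeroSum′ Q R (classify q r v₀) (classify q r v₁) (classify q r v₂)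

-- The component modulo a third prime

data Contribution (p : ℕ) : Bool → ℕ → Set where
  silent : ∀ {f x} → (∀ b → EqMod p (+ keep f (b ℕ.* x)) (+ 0)) → Contribution p f x
  active : ∀ {x} → NonZeroMod p (+ x) → Contribution p true x

activeCount : ∀ {p f x} → Contribution p f x → ℕ
activeCount (silent _) = 0
activeCount (active _) = 1

silent-off : ∀ {p x} → Contribution p false x
silent-off = silent (λ _ → eqMod-refl)

silent-zeroMod : ∀ {p f x} → ZeroMod p (+ x) → Contribution p f x
silent-zeroMod {f = f} x≡0 = silent (vanish f)
  where
  vanish : ∀ f b → EqMod _ (+ keep f (b ℕ.* _)) (+ 0)
  vanish true b = zeroMod⇒*-eqMod0 x≡0 b
  vanish false b = eqMod-refl

contribution : ∀ {p x} f → NonZeroMod p (+ x) → Contribution p f x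
contribution true nx = active nx
contribution false nx = silent-off

PZeroSum : ℕ → Bool → Bool → Bool → ℕ → ℕ → ℕ → Set
PZeroSum p f₀ f₁ f₂ x₀ x₁ x₂ =
  Σ ℕ λ b₀ → Σ ℕ λ b₁ → Σ ℕ λ b₂ → NonZeroMod p (+ b₀) × NonZeroMod p (+ b₁) × NonZeroMod p (+ b₂) ×
    p ∣ sum3 f₀ f₁ f₂ (b₀ ℕ.* x₀) (b₁ ℕ.* x₁) (b₂ ℕ.* x₂)

pZeroSum : ∀ {p f₀ f₁ f₂ x₀ x₁ x₂} → Prime≥7 p →
           (s₀ : Contribution p f₀ x₀) (s₁ : Contribution p f₁ x₁) (s₂ : Contribution p f₂ x₂) →
           activeCount s₀ ℕ.+ activeCount s₁ ℕ.+ activeCount s₂ ≢ 1 → PZeroSum p f₀ f₁ f₂ x₀ x₁ x₂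
pZeroSum P (silent z₀) (silent z₁) (silent z₂) _ = 1 , 1 , 1 , n1 , n1 , n1 , eqMod0⇒∣ (eqMod0-+₃ (z₀ 1) (z₁ 1) (z₂ 1))
  where n1 = nonZeroMod-1 P
pZeroSum P (active _) (silent _) (silent _) ≢1 = ⊥-elim (≢1 refl)
pZeroSum P (silent _) (active _) (silent _) ≢1 = ⊥-elim (≢1 refl)
pZeroSum P (silent _) (silent _) (active _) ≢1 = ⊥-elim (≢1 refl)
pZeroSum {x₀ = x₀} {x₁} P (active n₀) (active n₁) (silent z₂) _ =
  let b , nb , zp = solve-linear (isPrime P) x₁ (+ (1 ℕ.* x₀)) n₁ (nonZeroMod-*ℕ (isPrime P) (nonZeroMod-1 P) n₀)
  in 1 , b , 1 , nonZeroMod-1 P , nb , nonZeroMod-1 P , eqMod0⇒∣ (eqMod-+ (eqMod0-comm {a = + (b ℕ.* x₁)} {+ (1 ℕ.* x₀)} zp) (z₂ 1))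
pZeroSum {x₀ = x₀} {_} {x₂} P (active n₀) (silent z₁) (active n₂) _ =
  let b , nb , zp = solve-linear (isPrime P) x₂ (+ (1 ℕ.* x₀)) n₂ (nonZeroMod-*ℕ (isPrime P) (nonZeroMod-1 P) n₀)
  in 1 , 1 , b , nonZeroMod-1 P , nonZeroMod-1 P , nb ,
     eqMod0⇒∣ (eqMod0-+₃ᵐ {a = + (1 ℕ.* x₀)} {c = + (b ℕ.* x₂)} (eqMod0-comm {a = + (b ℕ.* x₂)} {+ (1 ℕ.* x₀)} zp) (z₁ 1))
pZeroSum {x₁ = x₁} {x₂} P (silent z₀) (active n₁) (active n₂) _ =
  let b , nb , zp = solve-linear (isPrime P) x₂ (+ (1 ℕ.* x₁)) n₂ (nonZeroMod-*ℕ (isPrime P) (nonZeroMod-1 P) n₁)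
  in 1 , 1 , b , nonZeroMod-1 P , nonZeroMod-1 P , nb ,
     eqMod0⇒∣ (eqMod0-+₃ˡ {b = + (1 ℕ.* x₁)} {c = + (b ℕ.* x₂)} (z₀ 1) (eqMod0-comm {a = + (b ℕ.* x₂)} {+ (1 ℕ.* x₁)} zp))
pZeroSum {p} {x₀ = x₀} {x₁} {x₂} P (active n₀) (active n₁) (active n₂) _ =
  let b₂ , b₂≡ , nsum = avoid-zero-sum P 1 x₁ 1 x₂ (nonZeroMod-1 P) n₂
      nb₂ : NonZeroMod p (+ b₂)
      nb₂ = [ (λ e → subst (λ t → NonZeroMod p (+ t)) (sym e) (nonZeroMod-1 P)) ,
              (λ e → subst (λ t → NonZeroMod p (+ t)) (sym e) (small-nonZeroMod P 4 (s≤s z≤n) (<-literal 4 7))) ]′ b₂≡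
      b₀ , nb₀ , zp = solve-linear (isPrime P) x₀ (+ (1 ℕ.* x₁) + + (b₂ ℕ.* x₂)) n₀ nsum
  in b₀ , 1 , b₂ , nb₀ , nonZeroMod-1 P , nb₂ ,
     eqMod0⇒∣ (eqMod-trans (≡⇒eqMod (ℤP.+-assoc (+ (b₀ ℕ.* x₀)) (+ (1 ℕ.* x₁)) (+ (b₂ ℕ.* x₂)))) zp)

liftToL : ∀ {p q r x₀ x₁ x₂} → Prime≥7 p → (m : MatchedZeroSum q r x₀ x₁ x₂) →
          (s₀ : Contribution p (MatchedZeroSum.f₀ m) x₀) (s₁ : Contribution p (MatchedZeroSum.f₁ m) x₁)
          (s₂ : Contribution p (MatchedZeroSum.f₂ m) x₂) →
          activeCount s₀ ℕ.+ activeCount s₁ ℕ.+ activeCount s₂ ≢ 1 → LZeroSum p q r x₀ x₁ x₂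
liftToL P m s₀ s₁ s₂ ≢1 =
  let b₀ , b₁ , b₂ , n₀ , n₁ , n₂ , zp = pZeroSum P s₀ s₁ s₂ ≢1 in mkL m b₀ b₁ b₂ n₀ n₁ n₂ zp

prime∣prime⇒≡ : ∀ {x q} → Prime x → Prime q → x ∣ q → x ≡ q
prime∣prime⇒≡ px pq x∣q with prime⇒irreducible pq x∣q
... | inj₁ x≡1 = ⊥-elim (prime≢1 px x≡1)
... | inj₂ x≡q = x≡q

distinct-prime-nonZeroMod : ∀ {q r} → Prime q → Prime r → q ≢ r → NonZeroMod q (+ r)
distinct-prime-nonZeroMod pq pr q≢r (zeroMod q∣r) = q≢r (prime∣prime⇒≡ pq pr q∣r)

nonZeroMod⇒∤ : ∀ {p a} → NonZeroMod p (+ a) → ¬ (p ∣ a)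
nonZeroMod⇒∤ na p∣a = na (zeroMod p∣a)

distinct-primes-coprime : ∀ {q r} → Prime q → Prime r → q ≢ r → Coprime q r
distinct-primes-coprime pq pr q≢r = ¬∣⇒coprime pr (λ r∣q → q≢r (sym (prime∣prime⇒≡ pr pq r∣q)))

coprime-*ʳ : ∀ {a m n} → Coprime a m → Coprime a n → Coprime a (m ℕ.* n)
coprime-*ʳ {a} {m} {n} a⊥m a⊥n {d} (d∣a , d∣mn) = a⊥n (d∣a , coprime-divisor d⊥m d∣mn)
  where
  d⊥m : Coprime d m
  d⊥m (e∣d , e∣m) = a⊥m (ℕD.∣-trans e∣d d∣a , e∣m)

coprime⇒∣* : ∀ {m n k} → Coprime m n → m ∣ k → n ∣ k → m ℕ.* n ∣ k
coprime⇒∣* {m} {n} m⊥n (divides j k≡jm) n∣k with coprime-divisor (Cop.sym m⊥n) (subst (n ∣_) (trans k≡jm (ℕP.*-comm j m)) n∣k)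
... | divides i j≡in = divides i (trans k≡jm (trans (cong (ℕ._* m) j≡in) (trans (ℕP.*-assoc i n m) (cong (i ℕ.*_) (ℕP.*-comm n m)))))

CRTIdempotent : ℕ → ℕ → Set
CRTIdempotent m k = Σ ℕ λ e → EqMod m (+ e) (+ 1) × k ∣ e

crt-idempotent : ∀ {m} → Prime m → (k : ℕ) → NonZeroMod m (+ k) → CRTIdempotent m k
crt-idempotent {m} pm k nk =
  let instance _ = prime⇒nonZero pm
      i , ki≡1 = inverse pm (+ k) nk
      w , w≡i = representative m i
  in k ℕ.* w , eqMod-trans (≡⇒eqMod (ℤP.pos-* k w)) (eqMod-trans (eqMod-* (eqMod-refl {a = + k}) w≡i) ki≡1) ,
     divides w (ℕP.*-comm k w)

unit-nonZeroModˡ : ∀ {p o a} → Prime p → Unit (p ℕ.* o) a → NonZeroMod p (+ a)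
unit-nonZeroModˡ {p} {o} pr u (zeroMod p∣a) = prime≢1 pr (u (p∣a , ℕD.∣m⇒∣m*n o ℕD.∣-refl))

unit-nonZeroModʳ : ∀ {p o a} → Prime o → Unit (p ℕ.* o) a → NonZeroMod o (+ a)
unit-nonZeroModʳ {p} {o} pr u (zeroMod o∣a) = prime≢1 pr (u (o∣a , ℕD.∣n⇒∣m*n p ℕD.∣-refl))

weightIf : Bool → ℕ → Maybe ℕ
weightIf true a = just a
weightIf false a = nothing

weights3 : Bool → Bool → Bool → ℕ → ℕ → ℕ → Fin 3 → Maybe ℕ
weights3 f₀ f₁ f₂ a₀ a₁ a₂ zero = weightIf f₀ a₀
weights3 f₀ f₁ f₂ a₀ a₁ a₂ (suc zero) = weightIf f₁ a₁
weights3 f₀ f₁ f₂ a₀ a₁ a₂ (suc (suc zero)) = weightIf f₂ a₂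

weights3-nonempty : ∀ f₀ f₁ f₂ a₀ a₁ a₂ → T (f₀ ∨ f₁ ∨ f₂) → ∃ λ i → Is-just (weights3 f₀ f₁ f₂ a₀ a₁ a₂ i)
weights3-nonempty true _ _ _ _ _ _ = zero , just tt
weights3-nonempty false true _ _ _ _ _ = suc zero , just tt
weights3-nonempty false false true _ _ _ _ = suc (suc zero) , just tt

term : Maybe ℕ → ℕ → ℕ
term (just a) x = a ℕ.* x
term nothing x = 0

wsum-head : ∀ {l} (w : Fin (suc l) → Maybe ℕ) (x : Seq (suc l)) → wsum w x ≡ term (w zero) (x zero) ℕ.+ wsum (w ∘ suc) (x ∘ suc)
wsum-head w x with w zero
... | just a = refl
... | nothing = refl

wsum-2 : (w : Fin 2 → Maybe ℕ) (x : Seq 2) → wsum w x ≡ term (w zero) (x zero) ℕ.+ term (w (suc zero)) (x (suc zero))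
wsum-2 w x = trans (wsum-head w x) (cong (term (w zero) (x zero) ℕ.+_) (trans (wsum-head (w ∘ suc) (x ∘ suc)) (ℕP.+-identityʳ _)))

wsum-3 : (w : Fin 3 → Maybe ℕ) (x : Seq 3) →
         wsum w x ≡ term (w zero) (x zero) ℕ.+ term (w (suc zero)) (x (suc zero)) ℕ.+ term (w (suc (suc zero))) (x (suc (suc zero)))
wsum-3 w x = trans (wsum-head w x) (trans (cong (term (w zero) (x zero) ℕ.+_) (wsum-2 (w ∘ suc) (x ∘ suc))) (sym (ℕP.+-assoc (term (w zero) (x zero)) _ _)))

term-weightIf : ∀ f a x → term (weightIf f a) x ≡ keep f (a ℕ.* x)
term-weightIf true a x = refl
term-weightIf false a x = refl

wsum-weights3 : ∀ f₀ f₁ f₂ a₀ a₁ a₂ (v : Seq 3) →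
                wsum (weights3 f₀ f₁ f₂ a₀ a₁ a₂) v ≡ sum3 f₀ f₁ f₂ (a₀ ℕ.* v zero) (a₁ ℕ.* v (suc zero)) (a₂ ℕ.* v (suc (suc zero)))
wsum-weights3 f₀ f₁ f₂ a₀ a₁ a₂ v =
  trans (wsum-3 (weights3 f₀ f₁ f₂ a₀ a₁ a₂) v)
        (cong₂ ℕ._+_ (cong₂ ℕ._+_ (term-weightIf f₀ a₀ (v zero)) (term-weightIf f₁ a₁ (v (suc zero)))) (term-weightIf f₂ a₂ (v (suc (suc zero)))))

isJust : Maybe ℕ → Bool
isJust (just _) = true
isJust nothing = false

weightOf : Maybe ℕ → ℕ
weightOf (just a) = a
weightOf nothing = 0

term≡keep : ∀ m x → term m x ≡ keep (isJust m) (weightOf m ℕ.* x)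
term≡keep (just a) x = refl
term≡keep nothing x = refl

isJust⇒≡just : ∀ m → T (isJust m) → m ≡ just (weightOf m)
isJust⇒≡just (just x) _ = refl

Is-just⇒isJust : ∀ {m} → Is-just m → T (isJust m)
Is-just⇒isJust (just _) = tt

keep-eqMod : ∀ {m} f {a c} v → EqMod m (+ a) (+ c) → EqMod m (+ keep f (a ℕ.* v)) (+ keep f (c ℕ.* v))
keep-eqMod true {a} {c} v e =
  eqMod-trans (≡⇒eqMod (ℤP.pos-* a v)) (eqMod-trans (eqMod-* e (eqMod-refl {a = + v})) (≡⇒eqMod (sym (ℤP.pos-* c v))))
keep-eqMod false v e = eqMod-refl

sum3-eqMod : ∀ {m} f₀ f₁ f₂ {a₀ a₁ a₂ c₀ c₁ c₂} v₀ v₁ v₂ →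
             EqMod m (+ a₀) (+ c₀) → EqMod m (+ a₁) (+ c₁) → EqMod m (+ a₂) (+ c₂) →
             EqMod m (+ sum3 f₀ f₁ f₂ (a₀ ℕ.* v₀) (a₁ ℕ.* v₁) (a₂ ℕ.* v₂))
                     (+ sum3 f₀ f₁ f₂ (c₀ ℕ.* v₀) (c₁ ℕ.* v₁) (c₂ ℕ.* v₂))
sum3-eqMod f₀ f₁ f₂ v₀ v₁ v₂ e₀ e₁ e₂ = eqMod-+ (eqMod-+ (keep-eqMod f₀ v₀ e₀) (keep-eqMod f₁ v₁ e₁)) (keep-eqMod f₂ v₂ e₂)

∣-respˡ-eqMod : ∀ {m x y} → EqMod m (+ x) (+ y) → m ∣ y → m ∣ x
∣-respˡ-eqMod e m∣y = eqMod0⇒∣ (eqMod-trans e (zeroMod⇒eqMod0 (zeroMod m∣y)))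

-- The one-term sequence (u₀) is zero-sum free as well.
davenport≥3 : ∀ {m A} (u : Seq 2) → ¬ HasWZS m A u → ∀ j → AllHaveWZS m A j → 3 ≤ j
davenport≥3 u ¬zs zero all with all (λ ())
... | _ , (() , _) , _
davenport≥3 {m} {A} u ¬zs (suc zero) all with all (λ _ → u zero)
... | w , (zero , just-w₀) , inA , m∣sum = ⊥-elim (¬zs (padded , (zero , just-w₀) , inA′ , subst (m ∣_) same-sum m∣sum))
  where
  padded : Fin 2 → Maybe ℕ
  padded zero = w zero
  padded (suc zero) = nothing
  inA′ : ∀ i a → padded i ≡ just a → A a
  inA′ zero = inA zero
  inA′ (suc zero) a ()
  same-sum : wsum w (λ _ → u zero) ≡ wsum padded u
  same-sum = trans (wsum-head w (λ _ → u zero)) (sym (wsum-2 padded u))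
davenport≥3 u ¬zs (suc (suc zero)) all = ⊥-elim (¬zs (all u))
davenport≥3 u ¬zs (suc (suc (suc j))) all = s≤s (s≤s (s≤s z≤n))

-- Lifting to S(qr) and L(pqr; p)

sign-square : ∀ s → s Sg.* (s Sg.* Sg.+) ≡ Sg.+
sign-square Sg.+ = refl
sign-square Sg.- = refl

sign-square′ : ∀ s σ → s Sg.* (σ Sg.* (σ Sg.* Sg.+)) ≡ s
sign-square′ Sg.+ Sg.+ = refl
sign-square′ Sg.+ Sg.- = refl
sign-square′ Sg.- Sg.+ = refl
sign-square′ Sg.- Sg.- = refl

sign-square⇒≡ : ∀ s t → s Sg.* (t Sg.* Sg.+) ≡ Sg.+ → s ≡ t
sign-square⇒≡ Sg.+ Sg.+ _ = refl
sign-square⇒≡ Sg.- Sg.- _ = refl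
sign-square⇒≡ Sg.+ Sg.- ()
sign-square⇒≡ Sg.- Sg.+ ()

any3-first : ∀ {a} b c → T a → T (a ∨ b ∨ c)
any3-first {true} b c _ = tt

any3-second : ∀ a {b} c → T b → T (a ∨ b ∨ c)
any3-second true c _ = tt
any3-second false {true} c _ = tt

any3-third : ∀ a b → T (a ∨ b ∨ true)
any3-third true b = tt
any3-third false true = tt
any3-third false false = tt

sgroup⇒unitZeroSum : ∀ {m l} {v : Seq l} → HasWZS m (SGrp m) v → HasWZS m (Unit m) v
sgroup⇒unitZeroSum (w , nonempty , inS , zs) = w , nonempty , (λ i a e → proj₁ (inS i a e)) , zs

jacobi-two-primes : ∀ {q r ps a σ} → Prime q → Prime r → All Prime ps → product ps ≡ q ℕ.* r → JacList ps a σ → σ ≡ Sg.+ →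
                    Σ Sign λ s → Leg q a s × Leg r a s
jacobi-two-primes pq pr [] e jac-[] _ = ⊥-elim (prime≢1 pq (ℕP.m*n≡1⇒m≡1 _ _ (sym e)))
jacobi-two-primes {q} {r} {x ∷ []} pq pr (px ∷ []) e (jac-∷ _ jac-[]) _ = ⊥-elim (prime≢1 pr (sym 1≡r))
  where
  instance _ = prime⇒nonZero pq
  x≡q : x ≡ q
  x≡q = sym (prime∣prime⇒≡ pq px (subst (q ∣_) (trans (sym e) (ℕP.*-identityʳ x)) (ℕD.∣m⇒∣m*n r ℕD.∣-refl)))
  1≡r : 1 ≡ r
  1≡r = ℕP.*-cancelˡ-≡ 1 r q (trans (cong (ℕ._* 1) (sym x≡q)) e)
jacobi-two-primes {q} {r} {x ∷ y ∷ []} {a} pq pr (px ∷ py ∷ []) e (jac-∷ {s = s} lx (jac-∷ {s = t} ly jac-[])) σ≡+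
  with euclidsLemma q r px (subst (x ∣_) e (ℕD.∣m⇒∣m*n _ ℕD.∣-refl))
... | inj₁ x∣q = s , subst (λ z → Leg z a s) x≡q lx , subst (λ z → Leg z a s) y≡r (subst (Leg y a) (sym (sign-square⇒≡ s t σ≡+)) ly)
  where
  instance _ = prime⇒nonZero pq
  x≡q : x ≡ q
  x≡q = prime∣prime⇒≡ px pq x∣q
  y≡r : y ≡ r
  y≡r = ℕP.*-cancelˡ-≡ y r q (trans (cong (q ℕ.*_) (sym (ℕP.*-identityʳ y))) (trans (cong (ℕ._* (y ℕ.* 1)) (sym x≡q)) e))
... | inj₂ x∣r = t , subst (λ z → Leg z a t) y≡q ly , subst (λ z → Leg z a t) x≡r (subst (Leg x a) (sign-square⇒≡ s t σ≡+) lx)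
  where
  instance _ = prime⇒nonZero pr
  x≡r : x ≡ r
  x≡r = prime∣prime⇒≡ px pr x∣r
  y≡q : y ≡ q
  y≡q = ℕP.*-cancelˡ-≡ y q r (trans (cong (r ℕ.*_) (sym (ℕP.*-identityʳ y))) (trans (cong (ℕ._* (y ℕ.* 1)) (sym x≡r)) (trans e (ℕP.*-comm q r))))
jacobi-two-primes {q} {r} {x ∷ y ∷ z ∷ rest} pq pr (px ∷ py ∷ pz ∷ _) e _ _ =
  ⊥-elim (prime≢1 pz (ℕP.m*n≡1⇒m≡1 z (product rest) (only-two (euclidsLemma q r px (subst (x ∣_) e (ℕD.∣m⇒∣m*n _ ℕD.∣-refl))))))
  where
  rest≡1 : ∀ {u v} → Prime u → Prime v → x ≡ u → x ℕ.* (y ℕ.* (z ℕ.* product rest)) ≡ u ℕ.* v → z ℕ.* product rest ≡ 1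
  rest≡1 {u} {v} pu pv refl e′ =
    ℕP.*-cancelˡ-≡ _ 1 v {{prime⇒nonZero pv}} (trans (cong (ℕ._* (z ℕ.* product rest)) (sym y≡v)) (trans yz≡v (sym (ℕP.*-identityʳ v))))
    where
    yz≡v : y ℕ.* (z ℕ.* product rest) ≡ v
    yz≡v = ℕP.*-cancelˡ-≡ _ v u {{prime⇒nonZero pu}} e′
    y≡v : y ≡ v
    y≡v = prime∣prime⇒≡ py pv (subst (y ∣_) yz≡v (ℕD.∣m⇒∣m*n _ ℕD.∣-refl))
  only-two : x ∣ q ⊎ x ∣ r → z ℕ.* product rest ≡ 1
  only-two (inj₁ x∣q) = rest≡1 pq pr (prime∣prime⇒≡ px pq x∣q) e
  only-two (inj₂ x∣r) = rest≡1 pr pq (prime∣prime⇒≡ px pr x∣r) (trans e (ℕP.*-comm q r))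

module SGroupCRT {q r : ℕ} (Q : Prime≥7 q) (R : Prime≥7 r) (q≢r : q ≢ r) where
  private
    idem-q : CRTIdempotent q r
    idem-q = crt-idempotent (isPrime Q) r (distinct-prime-nonZeroMod (isPrime Q) (isPrime R) q≢r)
    idem-r : CRTIdempotent r q
    idem-r = crt-idempotent (isPrime R) q (distinct-prime-nonZeroMod (isPrime R) (isPrime Q) (q≢r ∘ sym))

  crt : ℕ → ℕ → ℕ
  crt c d = c ℕ.* proj₁ idem-q ℕ.+ d ℕ.* proj₁ idem-r

  crt-q : ∀ c d → EqMod q (+ crt c d) (+ c)
  crt-q c d =
    eqMod-trans (eqMod-+ (eqMod-trans (≡⇒eqMod (ℤP.pos-* c _)) (eqMod-* (eqMod-refl {a = + c}) (proj₁ (proj₂ idem-q))))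
                         (zeroMod⇒*-eqMod0 (zeroMod (proj₂ (proj₂ idem-r))) d))
      (≡⇒eqMod (identity (+ c)))
    where
    identity : ∀ c → c * + 1 + + 0 ≡ c
    identity = solve-∀

  crt-r : ∀ c d → EqMod r (+ crt c d) (+ d)
  crt-r c d =
    eqMod-trans (eqMod-+ (zeroMod⇒*-eqMod0 (zeroMod (proj₂ (proj₂ idem-q))) c)
                         (eqMod-trans (≡⇒eqMod (ℤP.pos-* d _)) (eqMod-* (eqMod-refl {a = + d}) (proj₁ (proj₂ idem-r)))))
      (≡⇒eqMod (identity (+ d)))
    where
    identity : ∀ d → + 0 + d * + 1 ≡ d
    identity = solve-∀

  crt-∈S : ∀ {c d} → MatchedWeights q r c d → SGrp (q ℕ.* r) (crt c d)
  crt-∈S {c} {d} (s , (nc , leg-c) , (nd , leg-d)) =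
    coprime-*ʳ (¬∣⇒coprime (isPrime Q) (nonZeroMod⇒∤ (nonZeroMod-resp (eqMod-sym (crt-q c d)) nc)))
               (¬∣⇒coprime (isPrime R) (nonZeroMod⇒∤ (nonZeroMod-resp (eqMod-sym (crt-r c d)) nd))) ,
    (q ∷ r ∷ [] , isPrime Q ∷ isPrime R ∷ [] , cong (q ℕ.*_) (ℕP.*-identityʳ r) ,
     subst (JacList (q ∷ r ∷ []) (crt c d)) (sign-square s)
       (jac-∷ (leg-resp (eqMod-sym (crt-q c d)) leg-c) (jac-∷ (leg-resp (eqMod-sym (crt-r c d)) leg-d) jac-[])))

  weightIf-∈S : ∀ f c d → (T f → MatchedWeights q r c d) → ∀ a → weightIf f (crt c d) ≡ just a → SGrp (q ℕ.* r) a
  weightIf-∈S true c d w .(crt c d) refl = crt-∈S (w tt)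

  matched⇒weightedZeroSum : (v : Seq 3) → MatchedZeroSum q r (v zero) (v (suc zero)) (v (suc (suc zero))) →
                            HasWZS (q ℕ.* r) (SGrp (q ℕ.* r)) v
  matched⇒weightedZeroSum v (mkMatched f₀ f₁ f₂ ne c₀ c₁ c₂ d₀ d₁ d₂ w₀ w₁ w₂ zq zr) =
    weights3 f₀ f₁ f₂ a₀ a₁ a₂ , weights3-nonempty f₀ f₁ f₂ a₀ a₁ a₂ ne , inS ,
    subst (q ℕ.* r ∣_) (sym (wsum-weights3 f₀ f₁ f₂ a₀ a₁ a₂ v))
      (coprime⇒∣* (distinct-primes-coprime (isPrime Q) (isPrime R) q≢r)
        (∣-respˡ-eqMod (sum3-eqMod f₀ f₁ f₂ _ _ _ (crt-q c₀ d₀) (crt-q c₁ d₁) (crt-q c₂ d₂)) zq)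
        (∣-respˡ-eqMod (sum3-eqMod f₀ f₁ f₂ _ _ _ (crt-r c₀ d₀) (crt-r c₁ d₁) (crt-r c₂ d₂)) zr))
    where
    a₀ : ℕ
    a₀ = crt c₀ d₀
    a₁ : ℕ
    a₁ = crt c₁ d₁
    a₂ : ℕ
    a₂ = crt c₂ d₂
    inS : ∀ i a → weights3 f₀ f₁ f₂ a₀ a₁ a₂ i ≡ just a → SGrp (q ℕ.* r) a
    inS zero = weightIf-∈S f₀ c₀ d₀ w₀
    inS (suc zero) = weightIf-∈S f₁ c₁ d₁ w₁
    inS (suc (suc zero)) = weightIf-∈S f₂ c₂ d₂ w₂

  sgroup⇒matched : ∀ {a} → SGrp (q ℕ.* r) a → MatchedWeights q r a a
  sgroup⇒matched (u , ps , all-prime , ps≡ , jac) =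
    let instance _ = prime≥7⇒nonZero Q
        s , leg-q , leg-r = jacobi-two-primes (isPrime Q) (isPrime R) all-prime ps≡ jac refl
    in s , (unit-nonZeroModˡ (isPrime Q) u , leg-q) , (unit-nonZeroModʳ {q} (isPrime R) u , leg-r)

  weightedZeroSum⇒matched : (u : Seq 2) → HasWZS (q ℕ.* r) (SGrp (q ℕ.* r)) u → ∀ z → MatchedZeroSum q r (u zero) (u (suc zero)) z
  weightedZeroSum⇒matched u (w , (i , just-wi) , inS , zs) z =
    mkMatched f₀ f₁ false (nonempty i just-wi) a₀ a₁ 0 a₀ a₁ 0 matched₀ matched₁ (λ ())
      (ℕD.∣-trans (ℕD.∣m⇒∣m*n r ℕD.∣-refl) qr∣sum) (ℕD.∣-trans (ℕD.∣n⇒∣m*n q ℕD.∣-refl) qr∣sum)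
    where
    f₀ : Bool
    f₀ = isJust (w zero)
    f₁ : Bool
    f₁ = isJust (w (suc zero))
    a₀ : ℕ
    a₀ = weightOf (w zero)
    a₁ : ℕ
    a₁ = weightOf (w (suc zero))
    nonempty : ∀ i → Is-just (w i) → T (f₀ ∨ f₁ ∨ false)
    nonempty zero j = any3-first f₁ false (Is-just⇒isJust j)
    nonempty (suc zero) j = any3-second f₀ false (Is-just⇒isJust j)
    matched₀ : T f₀ → MatchedWeights q r a₀ a₀
    matched₀ t = sgroup⇒matched (inS zero a₀ (isJust⇒≡just (w zero) t))
    matched₁ : T f₁ → MatchedWeights q r a₁ a₁
    matched₁ t = sgroup⇒matched (inS (suc zero) a₁ (isJust⇒≡just (w (suc zero)) t))
    qr∣sum : q ℕ.* r ∣ sum3 f₀ f₁ false (a₀ ℕ.* u zero) (a₁ ℕ.* u (suc zero)) (0 ℕ.* z)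
    qr∣sum = subst (q ℕ.* r ∣_)
               (trans (wsum-2 w u) (trans (cong₂ ℕ._+_ (term≡keep (w zero) _) (term≡keep (w (suc zero)) _)) (sym (ℕP.+-identityʳ _))))
               zs

  sgroup-davenport : AllHaveWZS (q ℕ.* r) (SGrp (q ℕ.* r)) 3
  sgroup-davenport v = matched⇒weightedZeroSum v (matchedZeroSum Q R _ _ _)

  sgroup-extremal : (u : Seq 2) → ¬ HasWZS (q ℕ.* r) (SGrp (q ℕ.* r)) u → Extremal (q ℕ.* r) (SGrp (q ℕ.* r)) u
  sgroup-extremal u ¬zs = (sgroup-davenport , davenport≥3 u ¬zs) , ¬zs

  unit-extremal : (u : Seq 2) → ¬ HasWZS (q ℕ.* r) (Unit (q ℕ.* r)) u → Extremal (q ℕ.* r) (Unit (q ℕ.* r)) u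
  unit-extremal u ¬zs = ((λ v → sgroup⇒unitZeroSum (sgroup-davenport v)) , davenport≥3 u ¬zs) , ¬zs

distinct-primes-product : ∀ {p q r} → Prime p → Prime q → Prime r → p ≢ q → p ≢ r → NonZeroMod p (+ (q ℕ.* r))
distinct-primes-product {p} {q} {r} pp pq pr p≢q p≢r pqr≡0 =
  nonZeroMod-* pp (distinct-prime-nonZeroMod pp pq p≢q) (distinct-prime-nonZeroMod pp pr p≢r) (zeroMod-resp-≡ (ℤP.pos-* q r) pqr≡0)

module LGroupCRT {p q r : ℕ} (P : Prime≥7 p) (Q : Prime≥7 q) (R : Prime≥7 r) (p≢q : p ≢ q) (p≢r : p ≢ r) (q≢r : q ≢ r) where
  private
    idem-p : CRTIdempotent p (q ℕ.* r)
    idem-p = crt-idempotent (isPrime P) (q ℕ.* r) (distinct-primes-product (isPrime P) (isPrime Q) (isPrime R) p≢q p≢r)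
    idem-q : CRTIdempotent q (p ℕ.* r)
    idem-q = crt-idempotent (isPrime Q) (p ℕ.* r) (distinct-primes-product (isPrime Q) (isPrime P) (isPrime R) (p≢q ∘ sym) q≢r)
    idem-r : CRTIdempotent r (p ℕ.* q)
    idem-r = crt-idempotent (isPrime R) (p ℕ.* q) (distinct-primes-product (isPrime R) (isPrime P) (isPrime Q) (p≢r ∘ sym) (q≢r ∘ sym))
    ∣ˡ : ∀ {a b c} → a ℕ.* b ∣ c → a ∣ c
    ∣ˡ {a} {b} ab∣c = ℕD.∣-trans (ℕD.∣m⇒∣m*n b ℕD.∣-refl) ab∣c
    ∣ʳ : ∀ {a b c} → a ℕ.* b ∣ c → b ∣ c
    ∣ʳ {a} ab∣c = ℕD.∣-trans (ℕD.∣n⇒∣m*n a ℕD.∣-refl) ab∣c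

  N : ℕ
  N = p ℕ.* (q ℕ.* r)

  crt : ℕ → ℕ → ℕ → ℕ
  crt b c d = b ℕ.* proj₁ idem-p ℕ.+ c ℕ.* proj₁ idem-q ℕ.+ d ℕ.* proj₁ idem-r

  crt-p : ∀ b c d → EqMod p (+ crt b c d) (+ b)
  crt-p b c d =
    eqMod-trans (eqMod-+ (eqMod-+ (eqMod-trans (≡⇒eqMod (ℤP.pos-* b _)) (eqMod-* (eqMod-refl {a = + b}) (proj₁ (proj₂ idem-p))))
                                  (zeroMod⇒*-eqMod0 (zeroMod (∣ˡ {p} {r} (proj₂ (proj₂ idem-q)))) c))
                         (zeroMod⇒*-eqMod0 (zeroMod (∣ˡ {p} {q} (proj₂ (proj₂ idem-r)))) d))
      (≡⇒eqMod (identity (+ b)))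
    where
    identity : ∀ b → b * + 1 + + 0 + + 0 ≡ b
    identity = solve-∀

  crt-q : ∀ b c d → EqMod q (+ crt b c d) (+ c)
  crt-q b c d =
    eqMod-trans (eqMod-+ (eqMod-+ (zeroMod⇒*-eqMod0 (zeroMod (∣ˡ {q} {r} (proj₂ (proj₂ idem-p)))) b)
                                  (eqMod-trans (≡⇒eqMod (ℤP.pos-* c _)) (eqMod-* (eqMod-refl {a = + c}) (proj₁ (proj₂ idem-q)))))
                         (zeroMod⇒*-eqMod0 (zeroMod (∣ʳ {p} {q} (proj₂ (proj₂ idem-r)))) d))
      (≡⇒eqMod (identity (+ c)))
    where
    identity : ∀ c → + 0 + c * + 1 + + 0 ≡ c
    identity = solve-∀

  crt-r : ∀ b c d → EqMod r (+ crt b c d) (+ d)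
  crt-r b c d =
    eqMod-trans (eqMod-+ (eqMod-+ (zeroMod⇒*-eqMod0 (zeroMod (∣ʳ {q} {r} (proj₂ (proj₂ idem-p)))) b)
                                  (zeroMod⇒*-eqMod0 (zeroMod (∣ʳ {p} {r} (proj₂ (proj₂ idem-q)))) c))
                         (eqMod-trans (≡⇒eqMod (ℤP.pos-* d _)) (eqMod-* (eqMod-refl {a = + d}) (proj₁ (proj₂ idem-r)))))
      (≡⇒eqMod (identity (+ d)))
    where
    identity : ∀ d → + 0 + + 0 + d * + 1 ≡ d
    identity = solve-∀

  crt-∈L : ∀ {b c d} → NonZeroMod p (+ b) → MatchedWeights q r c d → LGrp N p (crt b c d)
  crt-∈L {b} {c} {d} nb (σ , (nc , leg-c) , (nd , leg-d)) =
    let s , leg-p = legendre p {{prime≥7⇒nonZero P}} (crt b c d) in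
    coprime-*ʳ (¬∣⇒coprime (isPrime P) (nonZeroMod⇒∤ (nonZeroMod-resp (eqMod-sym (crt-p b c d)) nb)))
      (coprime-*ʳ (¬∣⇒coprime (isPrime Q) (nonZeroMod⇒∤ (nonZeroMod-resp (eqMod-sym (crt-q b c d)) nc)))
                  (¬∣⇒coprime (isPrime R) (nonZeroMod⇒∤ (nonZeroMod-resp (eqMod-sym (crt-r b c d)) nd)))) ,
    s , (p ∷ q ∷ r ∷ [] , isPrime P ∷ isPrime Q ∷ isPrime R ∷ [] , cong (λ t → p ℕ.* (q ℕ.* t)) (ℕP.*-identityʳ r) ,
         subst (JacList (p ∷ q ∷ r ∷ []) (crt b c d)) (sign-square′ s σ)
           (jac-∷ leg-p (jac-∷ (leg-resp (eqMod-sym (crt-q b c d)) leg-c) (jac-∷ (leg-resp (eqMod-sym (crt-r b c d)) leg-d) jac-[])))) ,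
    leg-p

  weightIf-∈L : ∀ f b c d → NonZeroMod p (+ b) → (T f → MatchedWeights q r c d) → ∀ a → weightIf f (crt b c d) ≡ just a → LGrp N p a
  weightIf-∈L true b c d nb w .(crt b c d) refl = crt-∈L nb (w tt)

  lzs⇒weightedZeroSum : (v : Seq 3) → LZeroSum p q r (v zero) (v (suc zero)) (v (suc (suc zero))) → HasWZS N (LGrp N p) v
  lzs⇒weightedZeroSum v (mkL (mkMatched f₀ f₁ f₂ ne c₀ c₁ c₂ d₀ d₁ d₂ w₀ w₁ w₂ zq zr) b₀ b₁ b₂ n₀ n₁ n₂ zp) =
    weights3 f₀ f₁ f₂ a₀ a₁ a₂ , weights3-nonempty f₀ f₁ f₂ a₀ a₁ a₂ ne , inL ,
    subst (N ∣_) (sym (wsum-weights3 f₀ f₁ f₂ a₀ a₁ a₂ v))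
      (coprime⇒∣* p⊥qr (∣-respˡ-eqMod (sum3-eqMod f₀ f₁ f₂ _ _ _ (crt-p b₀ c₀ d₀) (crt-p b₁ c₁ d₁) (crt-p b₂ c₂ d₂)) zp)
        (coprime⇒∣* (distinct-primes-coprime (isPrime Q) (isPrime R) q≢r)
          (∣-respˡ-eqMod (sum3-eqMod f₀ f₁ f₂ _ _ _ (crt-q b₀ c₀ d₀) (crt-q b₁ c₁ d₁) (crt-q b₂ c₂ d₂)) zq)
          (∣-respˡ-eqMod (sum3-eqMod f₀ f₁ f₂ _ _ _ (crt-r b₀ c₀ d₀) (crt-r b₁ c₁ d₁) (crt-r b₂ c₂ d₂)) zr)))
    where
    a₀ : ℕ
    a₀ = crt b₀ c₀ d₀
    a₁ : ℕ
    a₁ = crt b₁ c₁ d₁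
    a₂ : ℕ
    a₂ = crt b₂ c₂ d₂
    p⊥qr : Coprime p (q ℕ.* r)
    p⊥qr = coprime-*ʳ (distinct-primes-coprime (isPrime P) (isPrime Q) p≢q) (distinct-primes-coprime (isPrime P) (isPrime R) p≢r)
    inL : ∀ i a → weights3 f₀ f₁ f₂ a₀ a₁ a₂ i ≡ just a → LGrp N p a
    inL zero = weightIf-∈L f₀ b₀ c₀ d₀ n₀ w₀
    inL (suc zero) = weightIf-∈L f₁ b₁ c₁ d₁ n₁ w₁
    inL (suc (suc zero)) = weightIf-∈L f₂ b₂ c₂ d₂ n₂ w₂

zeroMod-of-product : ∀ {m c v} → Prime m → NonZeroMod m (+ c) → m ∣ c ℕ.* v → ZeroMod m (+ v)
zeroMod-of-product {c = c} {v} pm nc m∣cv =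
  [ (λ c≡0 → ⊥-elim (nc c≡0)) , (λ v≡0 → v≡0) ]′ (euclid-zeroMod pm (+ c) (+ v) (zeroMod-resp-≡ (ℤP.pos-* c v) (zeroMod m∣cv)))

matched-nonZeroˡ : ∀ {q r c d} → MatchedWeights q r c d → NonZeroMod q (+ c)
matched-nonZeroˡ (_ , (nc , _) , _) = nc

matched-nonZeroʳ : ∀ {q r c d} → MatchedWeights q r c d → NonZeroMod r (+ d)
matched-nonZeroʳ (_ , _ , (nd , _)) = nd

data NonVanishing (q r v : ℕ) : Set where
  nvQ : NonZeroMod q (+ v) → ZeroMod r (+ v) → NonVanishing q r v
  nvR : ZeroMod q (+ v) → NonZeroMod r (+ v) → NonVanishing q r v
  nvF : NonZeroMod q (+ v) → NonZeroMod r (+ v) → NonVanishing q r v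

toResidue : ∀ {q r v} → NonVanishing q r v → Residue q r v
toResidue (nvQ a b) = onlyAtQ a b
toResidue (nvR a b) = onlyAtR a b
toResidue (nvF a b) = nowhereZero a b

classify′ : ∀ q r v → (ZeroMod q (+ v) × ZeroMod r (+ v)) ⊎ NonVanishing q r v
classify′ q r v with classify q r v
... | vanishing a b = inj₁ (a , b)
... | onlyAtQ a b = inj₂ (nvQ a b)
... | onlyAtR a b = inj₂ (nvR a b)
... | nowhereZero a b = inj₂ (nvF a b)

nonVanishing⇒¬zero : ∀ {q r v} → NonVanishing q r v → ¬ (ZeroMod q (+ v) × ZeroMod r (+ v))
nonVanishing⇒¬zero (nvQ nq _) (zq , _) = nq zq
nonVanishing⇒¬zero (nvR _ nr) (_ , zr) = nr zr
nonVanishing⇒¬zero (nvF nq _) (zq , _) = nq zq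

zeroMod-subst : ∀ {m a b} → a ≡ b → ZeroMod m (+ a) → ZeroMod m (+ b)
zeroMod-subst refl z = z

nonZeroMod-subst : ∀ {m a b} → a ≡ b → NonZeroMod m (+ a) → NonZeroMod m (+ b)
nonZeroMod-subst refl n = n

-- If p ∣ z₀, o ∤ z₀ and p ∤ z₁, a unit-weighted zero-sum can use z₁ (it would
-- survive mod p) and must then use z₀ alone (which survives mod o).
unit-pair-zeroSumFree : ∀ {p o} → Prime p → Prime o → (u : Seq 2) → ∀ {z₀ z₁} → u zero ≡ z₀ → u (suc zero) ≡ z₁ →
                        ZeroMod p (+ z₀) → NonZeroMod o (+ z₀) → NonZeroMod p (+ z₁) → ¬ HasWZS (p ℕ.* o) (Unit (p ℕ.* o)) u
unit-pair-zeroSumFree {p} {o} pp po u refl refl p∣z₀ o∤z₀ p∤z₁ (w , (i , just-wi) , inU , zs) =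
  no-zero-sum (w zero) (w (suc zero)) (inU zero) (inU (suc zero)) (used i just-wi) (subst (p ℕ.* o ∣_) (wsum-2 w u) zs)
  where
  used : ∀ i → Is-just (w i) → Is-just (w zero) ⊎ Is-just (w (suc zero))
  used zero j = inj₁ j
  used (suc zero) j = inj₂ j
  term-vanishes : ∀ m → EqMod p (+ term m (u zero)) (+ 0)
  term-vanishes (just a) = zeroMod⇒*-eqMod0 p∣z₀ a
  term-vanishes nothing = eqMod-refl
  no-zero-sum : ∀ m₀ m₁ → (∀ a → m₀ ≡ just a → Unit (p ℕ.* o) a) → (∀ a → m₁ ≡ just a → Unit (p ℕ.* o) a) →
                  Is-just m₀ ⊎ Is-just m₁ → p ℕ.* o ∣ term m₀ (u zero) ℕ.+ term m₁ (u (suc zero)) → ⊥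
  no-zero-sum m₀ (just a₁) _ unit₁ _ po∣sum =
    nonZeroMod-* pp (unit-nonZeroModˡ pp (unit₁ a₁ refl)) p∤z₁
      (zeroMod-resp-≡ (ℤP.pos-* a₁ _)
        (zeroMod-respˡ (eqMod-sym (eqMod-+ (term-vanishes m₀) (eqMod-refl {a = + (a₁ ℕ.* u (suc zero))})))
          (zeroMod (ℕD.∣-trans (ℕD.∣m⇒∣m*n o ℕD.∣-refl) po∣sum))))
  no-zero-sum (just a₀) nothing unit₀ _ _ po∣sum =
    nonZeroMod-* po (unit-nonZeroModʳ {p} po (unit₀ a₀ refl)) o∤z₀
      (zeroMod-resp-≡ (ℤP.pos-* a₀ _) (zeroMod (subst (o ∣_) (ℕP.+-identityʳ _) (ℕD.∣-trans (ℕD.∣n⇒∣m*n p ℕD.∣-refl) po∣sum))))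
  no-zero-sum nothing nothing _ _ (inj₁ ()) _
  no-zero-sum nothing nothing _ _ (inj₂ ()) _

pqr-rotate : ∀ p q r → r ℕ.* (p ℕ.* q) ≡ p ℕ.* (q ℕ.* r)
pqr-rotate = NS.solve-∀

pqr-swap : ∀ p q r → q ℕ.* (p ℕ.* r) ≡ p ℕ.* (q ℕ.* r)
pqr-swap = NS.solve-∀

-- From here on n = pqr for distinct primes p, q, r ≥ 7, and p plays the role of p′.
module Analysis {p q r : ℕ} (P : Prime≥7 p) (Q : Prime≥7 q) (R : Prime≥7 r) (p≢q : p ≢ q) (p≢r : p ≢ r) (q≢r : q ≢ r) where

  open LGroupCRT P Q R p≢q p≢r q≢r public
  module SQR = SGroupCRT Q R q≢r
  module SPR = SGroupCRT P R p≢r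
  module SPQ = SGroupCRT P Q p≢q
  module CQ = MatchedCases Q R
  module CR = MatchedCases R Q

  CaseI : ℕ → ℕ → ℕ → Set
  CaseI z₀ z₁ z₂ = ¬ (N ∣ z₂) × (q ℕ.* r ∣ z₂) ×
    ((u : Seq 2) → u zero ≡ z₀ → u (suc zero) ≡ z₁ → Extremal (q ℕ.* r) (SGrp (q ℕ.* r)) u)

  CaseII : ℕ → ℕ → ℕ → Set
  CaseII z₀ z₁ z₂ = Σ ℕ λ p₀ → Σ ℕ λ n′ → Prime p₀ × p₀ ℕ.* n′ ≡ N × ¬ (p₀ ∣ z₀) × p₀ ∣ z₁ × p₀ ∣ z₂ ×
    ((u : Seq 2) → u zero ≡ z₁ → u (suc zero) ≡ z₂ → Extremal n′ (SGrp n′) u × (p₀ ≢ p → Extremal n′ (Unit n′) u))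

  Cases : ℕ → ℕ → ℕ → Set
  Cases z₀ z₁ z₂ = CaseI z₀ z₁ z₂ ⊎ CaseII z₀ z₁ z₂

  data Order : Set where
    o012 o021 o102 o120 o201 o210 : Order

  CasesIn : Order → ℕ → ℕ → ℕ → Set
  CasesIn o012 x₀ x₁ x₂ = Cases x₀ x₁ x₂
  CasesIn o021 x₀ x₁ x₂ = Cases x₀ x₂ x₁
  CasesIn o102 x₀ x₁ x₂ = Cases x₁ x₀ x₂
  CasesIn o120 x₀ x₁ x₂ = Cases x₁ x₂ x₀
  CasesIn o201 x₀ x₁ x₂ = Cases x₂ x₀ x₁
  CasesIn o210 x₀ x₁ x₂ = Cases x₂ x₁ x₀

  PermutedCases : ℕ → ℕ → ℕ → Set
  PermutedCases x₀ x₁ x₂ = Σ Order λ o → CasesIn o x₀ x₁ x₂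

  permuted-swap01 : ∀ {x₀ x₁ x₂} → PermutedCases x₁ x₀ x₂ → PermutedCases x₀ x₁ x₂
  permuted-swap01 (o012 , c) = o102 , c
  permuted-swap01 (o021 , c) = o120 , c
  permuted-swap01 (o102 , c) = o012 , c
  permuted-swap01 (o120 , c) = o021 , c
  permuted-swap01 (o201 , c) = o210 , c
  permuted-swap01 (o210 , c) = o201 , c

  permuted-swap02 : ∀ {x₀ x₁ x₂} → PermutedCases x₂ x₁ x₀ → PermutedCases x₀ x₁ x₂
  permuted-swap02 (o012 , c) = o210 , c
  permuted-swap02 (o021 , c) = o201 , c
  permuted-swap02 (o102 , c) = o120 , c
  permuted-swap02 (o120 , c) = o102 , c
  permuted-swap02 (o201 , c) = o021 , c
  permuted-swap02 (o210 , c) = o012 , c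

  transport : ∀ {a b a′ b′ c} → a ≡ a′ → b ≡ b′ → LZeroSum p q r a b c → LZeroSum p q r a′ b′ c
  transport {c = c} = subst₂ (λ a b → LZeroSum p q r a b c)

  sum3-add-term : ∀ {m v₂} f₀ f₁ a b → m ∣ sum3 f₀ f₁ false a b 0 → m ∣ v₂ → m ∣ sum3 f₀ f₁ true a b (1 ℕ.* v₂)
  sum3-add-term {m} f₀ f₁ a b m∣sum m∣v₂ = ℕD.∣m∣n⇒∣m+n (subst (m ∣_) (ℕP.+-identityʳ _) m∣sum) (ℕD.∣n⇒∣m*n 1 m∣v₂)

  extend-by-multiple : ∀ {v₀ v₁ v₂} (m : MatchedZeroSum q r v₀ v₁ v₂) → MatchedZeroSum.f₂ m ≡ false →
                       ZeroMod q (+ v₂) → ZeroMod r (+ v₂) → MatchedZeroSum q r v₀ v₁ v₂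
  extend-by-multiple (mkMatched f₀ f₁ .false _ c₀ c₁ _ d₀ d₁ _ w₀ w₁ _ zq zr) refl (zeroMod q∣v₂) (zeroMod r∣v₂) =
    mkMatched f₀ f₁ true (any3-third f₀ f₁) c₀ c₁ 1 d₀ d₁ 1 w₀ w₁ (λ _ → CQ.matched-1)
      (sum3-add-term f₀ f₁ (c₀ ℕ.* _) (c₁ ℕ.* _) zq q∣v₂) (sum3-add-term f₀ f₁ (d₀ ℕ.* _) (d₁ ℕ.* _) zr r∣v₂)

  liftI : ∀ {v₀ v₁ v₂} (m : MatchedZeroSum q r v₀ v₁ v₂) → MatchedZeroSum.f₂ m ≡ false →
          NonZeroMod p (+ v₀) → NonZeroMod p (+ v₁) → NonZeroMod p (+ v₂) → ZeroMod q (+ v₂) → ZeroMod r (+ v₂) → LZeroSum p q r v₀ v₁ v₂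
  liftI m@(mkMatched f₀ f₁ .false ne _ _ _ _ _ _ _ _ _ _ _) refl n₀ n₁ n₂ zq₂ zr₂ =
    liftToL P (extend-by-multiple m refl zq₂ zr₂) (contribution f₀ n₀) (contribution f₁ n₁) (active n₂) (two-active f₀ f₁ ne)
    where
    two-active : ∀ f₀ f₁ → T (f₀ ∨ f₁ ∨ false) → activeCount (contribution {p} f₀ n₀) ℕ.+ activeCount (contribution {p} f₁ n₁) ℕ.+ 1 ≢ 1
    two-active true true _ ()
    two-active true false _ ()
    two-active false true _ ()

  liftI′ : ∀ {v₀ v₁ v₂} (m : MatchedZeroSum q r v₀ v₁ v₂) → MatchedZeroSum.f₂ m ≡ false →
           ZeroMod p (+ v₀) → NonZeroMod p (+ v₁) → NonZeroMod p (+ v₂) → ZeroMod q (+ v₂) → ZeroMod r (+ v₂) →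
           ¬ (ZeroMod q (+ v₀) × ZeroMod r (+ v₀)) → LZeroSum p q r v₀ v₁ v₂
  liftI′ m@(mkMatched _ true .false _ _ _ _ _ _ _ _ _ _ _ _) refl p∣v₀ n₁ n₂ zq₂ zr₂ _ =
    liftToL P (extend-by-multiple m refl zq₂ zr₂) (silent-zeroMod p∣v₀) (active n₁) (active n₂) (λ ())
  liftI′ (mkMatched true false .false _ _ _ _ _ _ _ w₀ _ _ zq zr) refl _ _ _ _ _ v₀≢0 =
    ⊥-elim (v₀≢0 (zeroMod-of-product (isPrime Q) (matched-nonZeroˡ (w₀ tt)) (subst (q ∣_) (trans (ℕP.+-identityʳ _) (ℕP.+-identityʳ _)) zq) ,
                  zeroMod-of-product (isPrime R) (matched-nonZeroʳ (w₀ tt)) (subst (r ∣_) (trans (ℕP.+-identityʳ _) (ℕP.+-identityʳ _)) zr)))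
  liftI′ (mkMatched false false .false () _ _ _ _ _ _ _ _ _ _ _) refl _ _ _ _ _ _

  liftII : ∀ {v₀ v₁ v₂} (m : MatchedZeroSum q r v₀ v₁ v₂) → MatchedZeroSum.f₂ m ≡ false →
           ZeroMod p (+ v₀) → ZeroMod p (+ v₁) → LZeroSum p q r v₀ v₁ v₂
  liftII m@(mkMatched _ _ .false _ _ _ _ _ _ _ _ _ _ _ _) refl p∣v₀ p∣v₁ =
    liftToL P m (silent-zeroMod p∣v₀) (silent-zeroMod p∣v₁) silent-off (λ ())

  caseI : ∀ z₀ z₁ z₂ → NonZeroMod p (+ z₂) → ZeroMod q (+ z₂) → ZeroMod r (+ z₂) →
          ((u : Seq 2) → u zero ≡ z₀ → u (suc zero) ≡ z₁ → ¬ HasWZS (q ℕ.* r) (SGrp (q ℕ.* r)) u) → CaseI z₀ z₁ z₂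
  caseI z₀ z₁ z₂ p∤z₂ (zeroMod q∣z₂) (zeroMod r∣z₂) ¬zs =
    (λ N∣z₂ → p∤z₂ (zeroMod (ℕD.∣-trans (ℕD.∣m⇒∣m*n (q ℕ.* r) ℕD.∣-refl) N∣z₂))) ,
    coprime⇒∣* (distinct-primes-coprime (isPrime Q) (isPrime R) q≢r) q∣z₂ r∣z₂ ,
    (λ u e₀ e₁ → SQR.sgroup-extremal u (¬zs u e₀ e₁))

  allZero : ∀ {y₀ y₁ y₂} → ZeroMod p (+ y₀) → ZeroMod p (+ y₁) → ZeroMod p (+ y₂) → LZeroSum p q r y₀ y₁ y₂
  allZero z₀ z₁ z₂ = liftToL P (matchedZeroSum Q R _ _ _) (silent-zeroMod z₀) (silent-zeroMod z₁) (silent-zeroMod z₂) (λ ())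

  oneNonZero : ∀ y₀ y₁ y₂ → NonZeroMod p (+ y₀) → ZeroMod p (+ y₁) → ZeroMod p (+ y₂) →
               ¬ LZeroSum p q r y₀ y₁ y₂ → PermutedCases y₀ y₁ y₂
  oneNonZero y₀ y₁ y₂ n₀ z₁ z₂ ¬L =
    o012 , inj₂ (p , q ℕ.* r , isPrime P , refl , nonZeroMod⇒∤ n₀ , ∣-of-zeroMod z₁ , ∣-of-zeroMod z₂ ,
                 λ u e₁ e₂ → SQR.sgroup-extremal u (¬zs u e₁ e₂) , (λ p≢p → ⊥-elim (p≢p refl)))
    where
    ¬zs : (u : Seq 2) → u zero ≡ y₁ → u (suc zero) ≡ y₂ → ¬ HasWZS (q ℕ.* r) (SGrp (q ℕ.* r)) u
    ¬zs u e₁ e₂ zs = ¬L (lzs-rotate (transport e₁ e₂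
                       (liftII (SQR.weightedZeroSum⇒matched u zs y₀) refl (zeroMod-subst (sym e₁) z₁) (zeroMod-subst (sym e₂) z₂))))

  -- By matchedZeroSum a matched zero-sum exists; as all three terms are nonzero
  -- mod p it lifts unless it consists of a single term, which is then ≡ 0 mod qr.
  noneZero : ∀ y₀ y₁ y₂ → NonZeroMod p (+ y₀) → NonZeroMod p (+ y₁) → NonZeroMod p (+ y₂) →
             ¬ LZeroSum p q r y₀ y₁ y₂ → PermutedCases y₀ y₁ y₂
  noneZero y₀ y₁ y₂ n₀ n₁ n₂ ¬L = from (matchedZeroSum Q R y₀ y₁ y₂)
    where
    at-least-two : ∀ f₂ → 1 ℕ.+ 1 ℕ.+ activeCount (contribution {p} f₂ n₂) ≢ 1
    at-least-two true ()
    at-least-two false ()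
    from : MatchedZeroSum q r y₀ y₁ y₂ → PermutedCases y₀ y₁ y₂
    from m@(mkMatched true true f₂ _ _ _ _ _ _ _ _ _ _ _ _) =
      ⊥-elim (¬L (liftToL P m (active n₀) (active n₁) (contribution f₂ n₂) (at-least-two f₂)))
    from m@(mkMatched true false true _ _ _ _ _ _ _ _ _ _ _ _) = ⊥-elim (¬L (liftToL P m (active n₀) silent-off (active n₂) (λ ())))
    from m@(mkMatched false true true _ _ _ _ _ _ _ _ _ _ _ _) = ⊥-elim (¬L (liftToL P m silent-off (active n₁) (active n₂) (λ ())))
    from (mkMatched false false false () _ _ _ _ _ _ _ _ _ _ _)
    from (mkMatched true false false _ _ _ _ _ _ _ w₀ _ _ zq zr) = o120 , inj₁ (caseI y₁ y₂ y₀ n₀ q∣y₀ r∣y₀ ¬zs)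
      where
      q∣y₀ : ZeroMod q (+ y₀)
      q∣y₀ = zeroMod-of-product (isPrime Q) (matched-nonZeroˡ (w₀ tt)) (subst (q ∣_) (trans (ℕP.+-identityʳ _) (ℕP.+-identityʳ _)) zq)
      r∣y₀ : ZeroMod r (+ y₀)
      r∣y₀ = zeroMod-of-product (isPrime R) (matched-nonZeroʳ (w₀ tt)) (subst (r ∣_) (trans (ℕP.+-identityʳ _) (ℕP.+-identityʳ _)) zr)
      ¬zs : (u : Seq 2) → u zero ≡ y₁ → u (suc zero) ≡ y₂ → ¬ HasWZS (q ℕ.* r) (SGrp (q ℕ.* r)) u
      ¬zs u e₁ e₂ zs = ¬L (lzs-rotate (transport e₁ e₂
                         (liftI (SQR.weightedZeroSum⇒matched u zs y₀) refl (nonZeroMod-subst (sym e₁) n₁) (nonZeroMod-subst (sym e₂) n₂)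
                                n₀ q∣y₀ r∣y₀)))
    from (mkMatched false true false _ _ _ _ _ _ _ _ w₁ _ zq zr) = o021 , inj₁ (caseI y₀ y₂ y₁ n₁ q∣y₁ r∣y₁ ¬zs)
      where
      q∣y₁ : ZeroMod q (+ y₁)
      q∣y₁ = zeroMod-of-product (isPrime Q) (matched-nonZeroˡ (w₁ tt)) (subst (q ∣_) (ℕP.+-identityʳ _) zq)
      r∣y₁ : ZeroMod r (+ y₁)
      r∣y₁ = zeroMod-of-product (isPrime R) (matched-nonZeroʳ (w₁ tt)) (subst (r ∣_) (ℕP.+-identityʳ _) zr)
      ¬zs : (u : Seq 2) → u zero ≡ y₀ → u (suc zero) ≡ y₂ → ¬ HasWZS (q ℕ.* r) (SGrp (q ℕ.* r)) u
      ¬zs u e₀ e₂ zs = ¬L (lzs-swap12 (transport e₀ e₂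
                         (liftI (SQR.weightedZeroSum⇒matched u zs y₁) refl (nonZeroMod-subst (sym e₀) n₀) (nonZeroMod-subst (sym e₂) n₂)
                                n₁ q∣y₁ r∣y₁)))
    from (mkMatched false false true _ _ _ _ _ _ _ _ _ w₂ zq zr) = o012 , inj₁ (caseI y₀ y₁ y₂ n₂ q∣y₂ r∣y₂ ¬zs)
      where
      q∣y₂ : ZeroMod q (+ y₂)
      q∣y₂ = zeroMod-of-product (isPrime Q) (matched-nonZeroˡ (w₂ tt)) zq
      r∣y₂ : ZeroMod r (+ y₂)
      r∣y₂ = zeroMod-of-product (isPrime R) (matched-nonZeroʳ (w₂ tt)) zr
      ¬zs : (u : Seq 2) → u zero ≡ y₀ → u (suc zero) ≡ y₁ → ¬ HasWZS (q ℕ.* r) (SGrp (q ℕ.* r)) u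
      ¬zs u e₀ e₁ zs = ¬L (transport e₀ e₁
                         (liftI (SQR.weightedZeroSum⇒matched u zs y₂) refl (nonZeroMod-subst (sym e₀) n₀) (nonZeroMod-subst (sym e₁) n₁)
                                n₂ q∣y₂ r∣y₂))

  caseII-at-r : ∀ {z₀ z₁} (u : Seq 2) → u zero ≡ z₀ → u (suc zero) ≡ z₁ →
                ZeroMod p (+ z₀) → NonZeroMod q (+ z₀) → NonZeroMod p (+ z₁) →
                Extremal (p ℕ.* q) (SGrp (p ℕ.* q)) u × (r ≢ p → Extremal (p ℕ.* q) (Unit (p ℕ.* q)) u)
  caseII-at-r u e₀ e₁ a b c =
    let ¬unit = unit-pair-zeroSumFree (isPrime P) (isPrime Q) u e₀ e₁ a b c
    in SPQ.sgroup-extremal u (¬unit ∘ sgroup⇒unitZeroSum) , (λ _ → SPQ.unit-extremal u ¬unit)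

  caseII-at-q : ∀ {z₀ z₁} (u : Seq 2) → u zero ≡ z₀ → u (suc zero) ≡ z₁ →
                ZeroMod p (+ z₀) → NonZeroMod r (+ z₀) → NonZeroMod p (+ z₁) →
                Extremal (p ℕ.* r) (SGrp (p ℕ.* r)) u × (q ≢ p → Extremal (p ℕ.* r) (Unit (p ℕ.* r)) u)
  caseII-at-q u e₀ e₁ a b c =
    let ¬unit = unit-pair-zeroSumFree (isPrime P) (isPrime R) u e₀ e₁ a b c
    in SPR.sgroup-extremal u (¬unit ∘ sgroup⇒unitZeroSum) , (λ _ → SPR.unit-extremal u ¬unit)

  -- Every matched zero-sum using both y₁ and y₂ lifts; the residue patterns of
  -- (y₁, y₂) that avoid this are exactly those of case (ii) at q or at r.
  residue-patterns : ∀ y₀ y₁ y₂ → ZeroMod p (+ y₀) → NonZeroMod p (+ y₁) → NonZeroMod p (+ y₂) → ¬ LZeroSum p q r y₀ y₁ y₂ →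
                     NonVanishing q r y₀ → NonVanishing q r y₁ → NonVanishing q r y₂ → PermutedCases y₀ y₁ y₂
  residue-patterns y₀ y₁ y₂ z₀ n₁ n₂ ¬L = by-residues
    where
    twoAtQ-lifts : NonZeroMod q (+ y₁) → ZeroMod r (+ y₁) → NonZeroMod q (+ y₂) → ZeroMod r (+ y₂) → ⊥
    twoAtQ-lifts a b c d = ¬L (lzs-rotate (liftToL P (CQ.twoAtQ a b c d) (active n₁) (active n₂) silent-off (λ ())))
    twoAtR-lifts : ZeroMod q (+ y₁) → NonZeroMod r (+ y₁) → ZeroMod q (+ y₂) → NonZeroMod r (+ y₂) → ⊥
    twoAtR-lifts a b c d = ¬L (lzs-rotate (liftToL P (matched-swapPrimes (CR.twoAtQ b a d c)) (active n₁) (active n₂) silent-off (λ ())))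
    both-used-lifts : (m : MatchedZeroSum q r y₀ y₁ y₂) → MatchedZeroSum.f₁ m ≡ true → MatchedZeroSum.f₂ m ≡ true → PermutedCases y₀ y₁ y₂
    both-used-lifts m@(mkMatched _ .true .true _ _ _ _ _ _ _ _ _ _ _ _) refl refl =
      ⊥-elim (¬L (liftToL P m (silent-zeroMod z₀) (active n₁) (active n₂) (λ ())))
    via-matched : NonVanishing q r y₀ → NonVanishing q r y₁ → NonVanishing q r y₂ → MatchedZeroSum q r y₀ y₁ y₂
    via-matched a b c = matchedZeroSum′ Q R (toResidue a) (toResidue b) (toResidue c)
    r-divides-y₀y₁ : NonZeroMod q (+ y₀) → ZeroMod r (+ y₀) → ZeroMod r (+ y₁) → NonZeroMod r (+ y₂) → PermutedCases y₀ y₁ y₂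
    r-divides-y₀y₁ a b c d =
      o201 , inj₂ (r , p ℕ.* q , isPrime R , pqr-rotate p q r , nonZeroMod⇒∤ d , ∣-of-zeroMod b , ∣-of-zeroMod c ,
                   λ u e₀ e₁ → caseII-at-r u e₀ e₁ z₀ a n₁)
    r-divides-y₀y₂ : NonZeroMod q (+ y₀) → ZeroMod r (+ y₀) → NonZeroMod r (+ y₁) → ZeroMod r (+ y₂) → PermutedCases y₀ y₁ y₂
    r-divides-y₀y₂ a b c d =
      o102 , inj₂ (r , p ℕ.* q , isPrime R , pqr-rotate p q r , nonZeroMod⇒∤ c , ∣-of-zeroMod b , ∣-of-zeroMod d ,
                   λ u e₀ e₂ → caseII-at-r u e₀ e₂ z₀ a n₂)
    q-divides-y₀y₁ : ZeroMod q (+ y₀) → NonZeroMod r (+ y₀) → ZeroMod q (+ y₁) → NonZeroMod q (+ y₂) → PermutedCases y₀ y₁ y₂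
    q-divides-y₀y₁ a b c d =
      o201 , inj₂ (q , p ℕ.* r , isPrime Q , pqr-swap p q r , nonZeroMod⇒∤ d , ∣-of-zeroMod a , ∣-of-zeroMod c ,
                   λ u e₀ e₁ → caseII-at-q u e₀ e₁ z₀ b n₁)
    q-divides-y₀y₂ : ZeroMod q (+ y₀) → NonZeroMod r (+ y₀) → NonZeroMod q (+ y₁) → ZeroMod q (+ y₂) → PermutedCases y₀ y₁ y₂
    q-divides-y₀y₂ a b c d =
      o102 , inj₂ (q , p ℕ.* r , isPrime Q , pqr-swap p q r , nonZeroMod⇒∤ c , ∣-of-zeroMod a , ∣-of-zeroMod d ,
                   λ u e₀ e₂ → caseII-at-q u e₀ e₂ z₀ b n₂)
    by-residues : NonVanishing q r y₀ → NonVanishing q r y₁ → NonVanishing q r y₂ → PermutedCases y₀ y₁ y₂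
    by-residues _ (nvQ a b) (nvQ c d) = ⊥-elim (twoAtQ-lifts a b c d)
    by-residues _ (nvR a b) (nvR c d) = ⊥-elim (twoAtR-lifts a b c d)
    by-residues (nvQ x y) (nvQ _ b) (nvR _ d) = r-divides-y₀y₁ x y b d
    by-residues (nvQ x y) (nvQ _ b) (nvF _ d) = r-divides-y₀y₁ x y b d
    by-residues (nvQ x y) (nvR _ b) (nvQ _ d) = r-divides-y₀y₂ x y b d
    by-residues (nvQ x y) (nvF _ b) (nvQ _ d) = r-divides-y₀y₂ x y b d
    by-residues (nvR x y) (nvR a _) (nvQ c _) = q-divides-y₀y₁ x y a c
    by-residues (nvR x y) (nvR a _) (nvF c _) = q-divides-y₀y₁ x y a c
    by-residues (nvR x y) (nvQ a _) (nvR c _) = q-divides-y₀y₂ x y a c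
    by-residues (nvR x y) (nvF a _) (nvR c _) = q-divides-y₀y₂ x y a c
    by-residues t₀@(nvF _ _) t₁@(nvQ _ _) t₂@(nvR _ _) = both-used-lifts (via-matched t₀ t₁ t₂) refl refl
    by-residues t₀@(nvF _ _) t₁@(nvR _ _) t₂@(nvQ _ _) = both-used-lifts (via-matched t₀ t₁ t₂) refl refl
    by-residues t₀@(nvF _ _) t₁@(nvF _ _) t₂@(nvQ _ _) = both-used-lifts (via-matched t₀ t₁ t₂) refl refl
    by-residues t₀@(nvF _ _) t₁@(nvQ _ _) t₂@(nvF _ _) = both-used-lifts (via-matched t₀ t₁ t₂) refl refl
    by-residues t₀@(nvF _ _) t₁@(nvF _ _) t₂@(nvR _ _) = both-used-lifts (via-matched t₀ t₁ t₂) refl refl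
    by-residues t₀@(nvF _ _) t₁@(nvR _ _) t₂@(nvF _ _) = both-used-lifts (via-matched t₀ t₁ t₂) refl refl
    by-residues t₀@(nvF _ _) t₁@(nvF _ _) t₂@(nvF _ _) = both-used-lifts (via-matched t₀ t₁ t₂) refl refl
    by-residues t₀@(nvQ _ _) t₁@(nvF _ _) t₂@(nvF _ _) = both-used-lifts (via-matched t₀ t₁ t₂) refl refl
    by-residues t₀@(nvQ _ _) t₁@(nvR _ _) t₂@(nvF _ _) = both-used-lifts (via-matched t₀ t₁ t₂) refl refl
    by-residues t₀@(nvQ _ _) t₁@(nvF _ _) t₂@(nvR _ _) = both-used-lifts (via-matched t₀ t₁ t₂) refl refl
    by-residues t₀@(nvR _ _) t₁@(nvF _ _) t₂@(nvF _ _) = both-used-lifts (via-matched t₀ t₁ t₂) refl refl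
    by-residues t₀@(nvR _ _) t₁@(nvQ _ _) t₂@(nvF _ _) = both-used-lifts (via-matched t₀ t₁ t₂) refl refl
    by-residues t₀@(nvR _ _) t₁@(nvF _ _) t₂@(nvQ _ _) = both-used-lifts (via-matched t₀ t₁ t₂) refl refl

  -- A term ≡ 0 mod qr gives case (i) or a zero-sum.
  oneZero : ∀ y₀ y₁ y₂ → ZeroMod p (+ y₀) → NonZeroMod p (+ y₁) → NonZeroMod p (+ y₂) →
            ¬ LZeroSum p q r y₀ y₁ y₂ → PermutedCases y₀ y₁ y₂
  oneZero y₀ y₁ y₂ z₀ n₁ n₂ ¬L with classify′ q r y₀
  ... | inj₁ (q∣y₀ , r∣y₀) = ⊥-elim (¬L (liftToL P (CQ.single q∣y₀ r∣y₀) (silent-zeroMod z₀) silent-off silent-off (λ ())))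
  ... | inj₂ t₀ with classify′ q r y₁
  ...   | inj₁ (q∣y₁ , r∣y₁) = o021 , inj₁ (caseI y₀ y₂ y₁ n₁ q∣y₁ r∣y₁ ¬zs)
    where
    ¬zs : (u : Seq 2) → u zero ≡ y₀ → u (suc zero) ≡ y₂ → ¬ HasWZS (q ℕ.* r) (SGrp (q ℕ.* r)) u
    ¬zs u e₀ e₂ zs = ¬L (lzs-swap12 (transport e₀ e₂
      (liftI′ (SQR.weightedZeroSum⇒matched u zs y₁) refl (zeroMod-subst (sym e₀) z₀) (nonZeroMod-subst (sym e₂) n₂) n₁ q∣y₁ r∣y₁
              (nonVanishing⇒¬zero t₀ ∘ Data.Product.map (zeroMod-subst e₀) (zeroMod-subst e₀)))))
  ...   | inj₂ t₁ with classify′ q r y₂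
  ...     | inj₁ (q∣y₂ , r∣y₂) = o012 , inj₁ (caseI y₀ y₁ y₂ n₂ q∣y₂ r∣y₂ ¬zs)
    where
    ¬zs : (u : Seq 2) → u zero ≡ y₀ → u (suc zero) ≡ y₁ → ¬ HasWZS (q ℕ.* r) (SGrp (q ℕ.* r)) u
    ¬zs u e₀ e₁ zs = ¬L (transport e₀ e₁
      (liftI′ (SQR.weightedZeroSum⇒matched u zs y₂) refl (zeroMod-subst (sym e₀) z₀) (nonZeroMod-subst (sym e₁) n₁) n₂ q∣y₂ r∣y₂
              (nonVanishing⇒¬zero t₀ ∘ Data.Product.map (zeroMod-subst e₀) (zeroMod-subst e₀))))
  ...     | inj₂ t₂ = residue-patterns y₀ y₁ y₂ z₀ n₁ n₂ ¬L t₀ t₁ t₂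

  analyse : ∀ y₀ y₁ y₂ → ¬ LZeroSum p q r y₀ y₁ y₂ → PermutedCases y₀ y₁ y₂
  analyse y₀ y₁ y₂ ¬L with zeroMod? p (+ y₀) | zeroMod? p (+ y₁) | zeroMod? p (+ y₂)
  ... | no a | no b | no c = noneZero y₀ y₁ y₂ a b c ¬L
  ... | yes a | no b | no c = oneZero y₀ y₁ y₂ a b c ¬L
  ... | no a | yes b | no c = permuted-swap01 (oneZero y₁ y₀ y₂ b a c (¬L ∘ lzs-swap01))
  ... | no a | no b | yes c = permuted-swap02 (oneZero y₂ y₁ y₀ c b a (¬L ∘ lzs-swap02))
  ... | no a | yes b | yes c = oneNonZero y₀ y₁ y₂ a b c ¬L
  ... | yes a | no b | yes c = permuted-swap01 (oneNonZero y₁ y₀ y₂ b a c (¬L ∘ lzs-swap01))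
  ... | yes a | yes b | no c = permuted-swap02 (oneNonZero y₂ y₁ y₀ c b a (¬L ∘ lzs-swap02))
  ... | yes a | yes b | yes c = ⊥-elim (¬L (allZero a b c))

Conclusion : ℕ → ℕ → Seq 3 → Set
Conclusion n p′ x =
  (Σ (Seq 3) λ y → Equiv n (LGrp n p′) x y
     × ¬ (n ∣ y (suc (suc zero)))
     × Σ ℕ λ n′ → p′ ℕ.* n′ ≡ n × n′ ∣ y (suc (suc zero))
       × Extremal n′ (SGrp n′) (λ (i : Fin 2) → y (inject₁ i)))
  ⊎ (Σ (Seq 3) λ y → Equiv n (LGrp n p′) x y
     × Σ ℕ λ p → Σ ℕ λ n′ → Prime p × p ℕ.* n′ ≡ n
       × ¬ (p ∣ y zero) × p ∣ y (suc zero) × p ∣ y (suc (suc zero))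
       × Extremal n′ (SGrp n′) (λ (i : Fin 2) → y (suc i))
       × (p ≢ p′ → Extremal n′ (Unit n′) (λ (i : Fin 2) → y (suc i))))

module Reorder {p q r : ℕ} (P : Prime≥7 p) (Q : Prime≥7 q) (R : Prime≥7 r) (p≢q : p ≢ q) (p≢r : p ≢ r) (q≢r : q ≢ r) where
  open Analysis P Q R p≢q p≢r q≢r

  lgroup-1 : LGrp N p 1
  lgroup-1 = (λ (d∣1 , _) → ℕD.∣1⇒≡1 d∣1) , Sg.+ ,
             (p ∷ q ∷ r ∷ [] , isPrime P ∷ isPrime Q ∷ isPrime R ∷ [] , cong (λ t → p ℕ.* (q ℕ.* t)) (ℕP.*-identityʳ r) ,
              jac-∷ (leg-square 1) (jac-∷ (leg-square 1) (jac-∷ (leg-square 1) jac-[]))) ,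
             leg-square 1

  permute-equiv : (x : Seq 3) (σ : Permutation′ 3) → Equiv N (LGrp N p) x (λ j → x (σ ⟨$⟩ˡ j))
  permute-equiv x σ =
    (λ _ → 1) , 1 , σ , (λ _ → lgroup-1) , (λ (d∣1 , _) → ℕD.∣1⇒≡1 d∣1) ,
    (λ i → eqMod⇒∣ (≡⇒eqMod (cong +_ (trans (cong x (inverseˡ σ)) (sym (ℕP.+-identityʳ (x i)))))))

  permutation-of : Order → Permutation′ 3
  permutation-of o012 = Perm.id
  permutation-of o021 = Perm.transpose 1F 2F
  permutation-of o102 = Perm.transpose 0F 1F
  permutation-of o120 = Perm.transpose 0F 1F Perm.∘ₚ Perm.transpose 1F 2F
  permutation-of o201 = Perm.transpose 1F 2F Perm.∘ₚ Perm.transpose 0F 1F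
  permutation-of o210 = Perm.transpose 0F 2F

  fromCases : (x : Seq 3) (σ : Permutation′ 3) → Cases (x (σ ⟨$⟩ˡ zero)) (x (σ ⟨$⟩ˡ suc zero)) (x (σ ⟨$⟩ˡ suc (suc zero))) → Conclusion N p x
  fromCases x σ (inj₁ (¬N∣ , qr∣ , extremal)) =
    inj₁ ((λ j → x (σ ⟨$⟩ˡ j)) , permute-equiv x σ , ¬N∣ , q ℕ.* r , refl , qr∣ , extremal _ refl refl)
  fromCases x σ (inj₂ (p₀ , n′ , prime-p₀ , n≡ , ∤₀ , ∣₁ , ∣₂ , extremal)) =
    inj₂ ((λ j → x (σ ⟨$⟩ˡ j)) , permute-equiv x σ , p₀ , n′ , prime-p₀ , n≡ , ∤₀ , ∣₁ , ∣₂ ,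
          proj₁ (extremal _ refl refl) , proj₂ (extremal _ refl refl))

  fromPermuted : (x : Seq 3) → PermutedCases (x zero) (x (suc zero)) (x (suc (suc zero))) → Conclusion N p x
  fromPermuted x (o , cases) = fromCases x (permutation-of o) (reindex o cases)
    where
    reindex : ∀ o → CasesIn o (x zero) (x (suc zero)) (x (suc (suc zero))) →
              Cases (x (permutation-of o ⟨$⟩ˡ zero)) (x (permutation-of o ⟨$⟩ˡ suc zero)) (x (permutation-of o ⟨$⟩ˡ suc (suc zero)))
    reindex o012 c = c
    reindex o021 c = c
    reindex o102 c = c
    reindex o120 c = c
    reindex o201 c = c
    reindex o210 c = c

  zeroSumFree⇒conclusion : (x : Seq 3) → ¬ HasWZS N (LGrp N p) x → Conclusion N p x
  zeroSumFree⇒conclusion x ¬zs = fromPermuted x (analyse _ _ _ (¬zs ∘ lzs⇒weightedZeroSum x))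

mkPrime≥7 : ∀ {p} → Prime p → 7 ≤ p → Prime≥7 p
mkPrime≥7 {p} pp 7≤p = record { isPrime = pp ; half = p ℕ./ 2 ; odd = p≡2h+1 ; 7≤p = 7≤p }
  where
  p%2≡1 : p ℕ.% 2 ≡ 1
  p%2≡1 with p ℕ.% 2 | ℕM.m%n<n p 2 | ℕM.m≡m%n+[m/n]*n p 2
  ... | zero | _ | p≡ = ⊥-elim (ℕP.<⇒≢ (ℕP.<-≤-trans (<-literal 2 7) 7≤p) (prime∣prime⇒≡ prime[2] pp (divides (p ℕ./ 2) p≡)))
  ... | suc zero | _ | _ = refl
  ... | suc (suc _) | s≤s (s≤s ()) | _
  p≡2h+1 : p ≡ suc (p ℕ./ 2 ℕ.+ p ℕ./ 2)
  p≡2h+1 = trans (ℕM.m≡m%n+[m/n]*n p 2)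
             (trans (cong (ℕ._+ (p ℕ./ 2) ℕ.* 2) p%2≡1) (cong suc (trans (ℕP.*-comm (p ℕ./ 2) 2) (cong (p ℕ./ 2 ℕ.+_) (ℕP.+-identityʳ _)))))

record DistinctPrimes≥7 (n : ℕ) : Set where
  field
    {p q r} : ℕ
    P : Prime≥7 p
    Q : Prime≥7 q
    R : Prime≥7 r
    p≢q : p ≢ q
    p≢r : p ≢ r
    q≢r : q ≢ r
    n≡pqr : p ℕ.* (q ℕ.* r) ≡ n

squarefree-primes : ∀ {n} → SquareFree n → (∀ q → Prime q → q ∣ n → 7 ≤ q) → BigOmega n 3 → DistinctPrimes≥7 n
squarefree-primes {n} sf ≥7 (a ∷ b ∷ c ∷ [] , pa ∷ pb ∷ pc ∷ [] , abc≡n , refl) = record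
  { P = mkPrime≥7 pa (≥7 a pa a∣n) ; Q = mkPrime≥7 pb (≥7 b pb b∣n) ; R = mkPrime≥7 pc (≥7 c pc c∣n)
  ; p≢q = a≢b ; p≢r = a≢c ; q≢r = b≢c ; n≡pqr = trans (cong (λ t → a ℕ.* (b ℕ.* t)) (sym (ℕP.*-identityʳ c))) abc≡n }
  where
  divides-n : ∀ {d} → d ∣ a ℕ.* (b ℕ.* (c ℕ.* 1)) → d ∣ n
  divides-n = subst (_ ∣_) abc≡n
  a∣n : a ∣ n
  a∣n = divides-n (ℕD.∣m⇒∣m*n _ ℕD.∣-refl)
  b∣n : b ∣ n
  b∣n = divides-n (ℕD.∣n⇒∣m*n a (ℕD.∣m⇒∣m*n _ ℕD.∣-refl))
  c∣n : c ∣ n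
  c∣n = divides-n (ℕD.∣n⇒∣m*n a (ℕD.∣n⇒∣m*n b (ℕD.∣m⇒∣m*n 1 ℕD.∣-refl)))
  a≢b : a ≢ b
  a≢b refl = sf a pa (divides-n (divides (c ℕ.* 1) (square-first a c)))
    where
    square-first : ∀ a c → a ℕ.* (a ℕ.* (c ℕ.* 1)) ≡ c ℕ.* 1 ℕ.* (a ℕ.* a)
    square-first = NS.solve-∀
  a≢c : a ≢ c
  a≢c refl = sf a pa (divides-n (divides b (square-apart a b)))
    where
    square-apart : ∀ a b → a ℕ.* (b ℕ.* (a ℕ.* 1)) ≡ b ℕ.* (a ℕ.* a)
    square-apart = NS.solve-∀
  b≢c : b ≢ c
  b≢c refl = sf b pb (divides-n (ℕD.∣n⇒∣m*n a (subst ((b ℕ.* b) ∣_) (cong (b ℕ.*_) (sym (ℕP.*-identityʳ b))) ℕD.∣-refl)))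
squarefree-primes sf ≥7 ([] , _ , _ , ())
squarefree-primes sf ≥7 (_ ∷ [] , _ , _ , ())
squarefree-primes sf ≥7 (_ ∷ _ ∷ [] , _ , _ , ())
squarefree-primes sf ≥7 (_ ∷ _ ∷ _ ∷ _ ∷ _ , _ , _ , ())

lead-with : ∀ {n p′} → DistinctPrimes≥7 n → Prime p′ → p′ ∣ n → Σ (DistinctPrimes≥7 n) λ t → DistinctPrimes≥7.p t ≡ p′
lead-with {n} {p′} t pp′ p′∣n with euclidsLemma p (q ℕ.* r) pp′ (subst (p′ ∣_) (sym n≡pqr) p′∣n)
  where open DistinctPrimes≥7 t
... | inj₁ p′∣p = t , sym (prime∣prime⇒≡ pp′ (isPrime P) p′∣p)
  where open DistinctPrimes≥7 t
... | inj₂ p′∣qr with euclidsLemma q r pp′ p′∣qr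
  where open DistinctPrimes≥7 t
...   | inj₁ p′∣q = record { P = Q ; Q = P ; R = R ; p≢q = p≢q ∘ sym ; p≢r = q≢r ; q≢r = p≢r ; n≡pqr = trans (pqr-swap p q r) n≡pqr } ,
                   sym (prime∣prime⇒≡ pp′ (isPrime Q) p′∣q)
  where open DistinctPrimes≥7 t
...   | inj₂ p′∣r = record { P = R ; Q = P ; R = Q ; p≢q = p≢r ∘ sym ; p≢r = q≢r ∘ sym ; q≢r = p≢q ; n≡pqr = trans (pqr-rotate p q r) n≡pqr } ,
                   sym (prime∣prime⇒≡ pp′ (isPrime R) p′∣r)
  where open DistinctPrimes≥7 t

zeroSumFree⇒conclusion : ∀ {n} (t : DistinctPrimes≥7 n) (x : Seq 3) →
                         ¬ HasWZS n (LGrp n (DistinctPrimes≥7.p t)) x → Conclusion n (DistinctPrimes≥7.p t) x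
zeroSumFree⇒conclusion record { P = P ; Q = Q ; R = R ; p≢q = p≢q ; p≢r = p≢r ; q≢r = q≢r ; n≡pqr = refl } =
  Reorder.zeroSumFree⇒conclusion P Q R p≢q p≢r q≢r

theorem5p3 : (n : ℕ) → ¬ (2 ∣ n) → SquareFree n → BigOmega n 3
    → (∀ q → Prime q → q ∣ n → 7 ≤ q)
    → (p' : ℕ) → Prime p' → p' ∣ n
    → (x : Seq 3) → Extremal n (LGrp n p') x
    → (Σ (Seq 3) λ y → Equiv n (LGrp n p') x y
         × ¬ (n ∣ y (suc (suc zero)))
         × Σ ℕ λ n' → p' ℕ.* n' ≡ n × n' ∣ y (suc (suc zero))
           × Extremal n' (SGrp n') (λ (i : Fin 2) → y (inject₁ i)))
      ⊎ (Σ (Seq 3) λ y → Equiv n (LGrp n p') x y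
         × Σ ℕ λ p → Σ ℕ λ n' → Prime p × p ℕ.* n' ≡ n
           × ¬ (p ∣ y zero) × p ∣ y (suc zero) × p ∣ y (suc (suc zero))
           × Extremal n' (SGrp n') (λ (i : Fin 2) → y (suc i))
           × (p ≢ p' → Extremal n' (Unit n') (λ (i : Fin 2) → y (suc i))))
-- Neither the oddness of n nor the value of D_A(n) is needed.
theorem5p3 n _ squarefree Ω≡3 ≥7 p′ prime-p′ p′∣n x (_ , zeroSumFree) =
  let t , p≡p′ = lead-with (squarefree-primes squarefree ≥7 Ω≡3) prime-p′ p′∣n
  in subst (λ p → Conclusion n p x) p≡p′
       (zeroSumFree⇒conclusion t x (subst (λ p → ¬ HasWZS n (LGrp n p) x) (sym p≡p′) zeroSumFree))
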